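{- For each odd prime $p$ there is a semi-regular skew-type quaternary Hadamard matrix of order $2+2p^2$.
   Context: A quaternary Hadamard matrix of order $n$ is an $n\times n$ matrix $H$ with entries in $\{1,-1,i,-i\}$ such that $HH^*=nI_n$, where $H^*$ is the conjugate transpose. It is of skew type if $H=I+Q$ with $Q^*=-Q$. A quaternary Hadamard matrix of order $n=a^2+b^2$ (with $a,b$ integers) is semi-regular if all its row sums belong to the set $\{\pm a\pm bi,\ \pm b\pm ai\}$. -}

module Defs where

open import Data.Nat as ℕ using (ℕ)
open import Data.Integer as ℤ using (ℤ; +_; 0ℤ; 1ℤ)
open import Data.Fin using (Fin; zero; suc)
open import Data.Product using (_×_; _,_; ∃-syntax; Σ-syntax)
open import Data.Sum using (_⊎_)
open import Relation.Binary.PropositionalEquality using (_≡_)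
open import Relation.Nullary using (¬_)

record ℤ[i] : Set where
  constructor _+_i
  field
    re : ℤ
    im : ℤ
open ℤ[i] public

infixl 6 _⊕_ _⊖_
infixl 7 _⊗_

_⊕_ : ℤ[i] → ℤ[i] → ℤ[i]
(a + b i) ⊕ (c + d i) = (a ℤ.+ c) + (b ℤ.+ d) i

⊝_ : ℤ[i] → ℤ[i]
⊝ (a + b i) = (ℤ.- a) + (ℤ.- b) i

_⊖_ : ℤ[i] → ℤ[i] → ℤ[i]
x ⊖ y = x ⊕ (⊝ y)

_⊗_ : ℤ[i] → ℤ[i] → ℤ[i]
(a + b i) ⊗ (c + d i) = (a ℤ.* c ℤ.- b ℤ.* d) + (a ℤ.* d ℤ.+ b ℤ.* c) i

conj : ℤ[i] → ℤ[i]
conj (a + b i) = a + (ℤ.- b) i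

0ᵢ : ℤ[i]
0ᵢ = 0ℤ + 0ℤ i

fromℕ : ℕ → ℤ[i]
fromℕ n = (+ n) + 0ℤ i

∑ : (n : ℕ) → (Fin n → ℤ[i]) → ℤ[i]
∑ ℕ.zero    f = 0ᵢ
∑ (ℕ.suc n) f = f zero ⊕ ∑ n (λ k → f (suc k))

δ : {n : ℕ} → Fin n → Fin n → ℤ[i]
δ zero    zero    = fromℕ 1
δ zero    (suc _) = 0ᵢ
δ (suc _) zero    = 0ᵢ
δ (suc j) (suc k) = δ j k

data Quat : Set where
  q1 qm1 qi qmi : Quat

⟦_⟧ : Quat → ℤ[i]
⟦ q1  ⟧ = 1ℤ + 0ℤ i
⟦ qm1 ⟧ = ℤ.-1ℤ + 0ℤ i
⟦ qi  ⟧ = 0ℤ + 1ℤ i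
⟦ qmi ⟧ = 0ℤ + ℤ.-1ℤ i

QMatrix : ℕ → Set
QMatrix n = Fin n → Fin n → Quat

IsQuaternaryHadamard : (n : ℕ) → QMatrix n → Set
IsQuaternaryHadamard n H =
  ∀ (j k : Fin n) → ∑ n (λ l → ⟦ H j l ⟧ ⊗ conj ⟦ H k l ⟧) ≡ fromℕ n ⊗ δ j k

IsSkewType : (n : ℕ) → QMatrix n → Set
IsSkewType n H =
  ∀ (j k : Fin n) → conj (Q k j) ≡ ⊝ (Q j k)
  where
    Q : Fin n → Fin n → ℤ[i]
    Q j k = ⟦ H j k ⟧ ⊖ δ j k

rowSum : (n : ℕ) → QMatrix n → Fin n → ℤ[i]
rowSum n H j = ∑ n (λ l → ⟦ H j l ⟧)

InSemiRegularSet : ℤ → ℤ → ℤ[i] → Set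
InSemiRegularSet a b z =
  ((re z ≡ a ⊎ re z ≡ ℤ.- a) × (im z ≡ b ⊎ im z ≡ ℤ.- b))
  ⊎ ((re z ≡ b ⊎ re z ≡ ℤ.- b) × (im z ≡ a ⊎ im z ≡ ℤ.- a))

IsSemiRegular : (n : ℕ) → QMatrix n → Set
IsSemiRegular n H =
  ∃[ a ] ∃[ b ] ((+ n ≡ a ℤ.* a ℤ.+ b ℤ.* b)
                 × (∀ (j : Fin n) → InSemiRegularSet a b (rowSum n H j)))

{-# OPTIONS --safe #-}
-- Write p = 2h + 1 and let ε alternate in sign. The p + 1 parallel classes of lines of the affine
-- plane over 𝔽ₚ, weighted by ε, give a symmetric ±1 matrix S of order p² with zero diagonal (two
-- distinct points span exactly one line), S 1 = 0 and S Sᵀ = p² I − J (lines of different classes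
-- meet once, and ε sums to 0 over the p + 1 classes). The sign vector σ(a, b) = ε(a) is constant on
-- vertical lines, so S σ = p σ − 1 and Σ σ = p; bordering S by σ gives a symmetric conference matrix
-- C of order m = p² + 1 with C Cᵀ = p² I and all row sums p. Then H = X ⊗ I + Y ⊗ C with
-- X = [[1, i], [i, 1]] and Y = [[i, −1], [1, −i]] is a skew-type quaternary Hadamard matrix of order
-- 2m whose row sums are (1 − p) + (1 + p) i or (1 + p) + (1 − p) i, and 2m = (p + 1)² + (p − 1)².
module Submission where

open import Defs
open import Algebra.Bundles using (CommutativeRing; Semiring)
open import Algebra.Consequences.Propositional using (comm∧idˡ⇒idʳ; comm∧invˡ⇒invʳ; comm∧distrˡ⇒distrʳ)
import Algebra.Properties.Semiring.Sum as SemiringSum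
open import Data.Bool.Base using (if_then_else_)
open import Data.Fin.Base using (Fin; zero; suc; toℕ; _↑ˡ_; _↑ʳ_; combine; remQuot; punchIn)
open import Data.Fin.Properties using (remQuot-combine; combine-remQuot; punchInᵢ≢i)
open import Data.Integer.Base using (ℤ; +_; 0ℤ; 1ℤ; -1ℤ)
import Data.Integer.Properties as ℤₚ
open import Data.Integer.Tactic.RingSolver using (solve-∀)
open import Data.Maybe.Base using (just; nothing)
open import Data.Nat.Base as ℕ using (ℕ; zero; suc)
open import Data.Nat.Primality using (Prime; prime⇒nonZero; prime⇒nonTrivial; prime⇒irreducible; euclidsLemma)
import Data.Nat.Properties as ℕₚ
import Data.Nat.Divisibility as ℕ∣
open import Data.Product.Base using (_×_; _,_; proj₁; proj₂; ∃-syntax; uncurry)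
open import Data.Product.Properties using (≡-dec; ,-injectiveˡ; ,-injectiveʳ)
open import Data.Sum.Base using (_⊎_; inj₁; inj₂)
open import Function.Base using (_∘_)
open import Relation.Binary.Definitions using (DecidableEquality)
open import Relation.Binary.PropositionalEquality
  using (_≡_; _≢_; refl; sym; trans; cong; cong₂; subst; isEquivalence; module ≡-Reasoning)
open import Relation.Nullary.Decidable using (Dec; yes; no; does; _×-dec_; dec-true; dec-false)
open import Relation.Nullary.Negation using (¬_; contradiction)
open import Tactic.RingSolver.Core.AlmostCommutativeRing using (AlmostCommutativeRing; fromCommutativeRing)
import Tactic.RingSolver.NonReflective as NonReflective

open SemiringSum ℤₚ.+-*-semiring
  using (sum; sum-cong-≗; ∑-distrib-+; ∑-comm; *-distribˡ-sum; *-distribʳ-sum; sum-remove; sum-replicate-zero)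

module FiniteSums {c ℓ} (R : Semiring c ℓ) where
  open Semiring R using (Carrier; _≈_; _+_; +-congˡ; +-identityˡ; +-assoc)
    renaming (refl to ≈-refl; sym to ≈-sym; trans to ≈-trans; reflexive to ≈-reflexive)
  open SemiringSum R using () renaming (sum to sumᴿ; sum-cong-≗ to sumᴿ-cong-≗)

  sum-↑ : ∀ m {n} (f : Fin (m ℕ.+ n) → Carrier) → sumᴿ f ≈ sumᴿ (λ a → f (a ↑ˡ n)) + sumᴿ (λ b → f (m ↑ʳ b))
  sum-↑ zero f = ≈-sym (+-identityˡ _)
  sum-↑ (suc m) f = ≈-trans (+-congˡ (sum-↑ m (f ∘ suc))) (≈-sym (+-assoc _ _ _))

  sum-combine : ∀ m {n} (f : Fin (m ℕ.* n) → Carrier) → sumᴿ f ≈ sumᴿ {m} (λ a → sumᴿ {n} (λ b → f (combine a b)))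
  sum-combine zero f = ≈-refl
  sum-combine (suc m) {n} f = ≈-trans (sum-↑ n f) (+-congˡ (sum-combine m {n} (λ k → f (n ↑ʳ k))))

  sum-remQuot : ∀ m n (g : Fin m × Fin n → Carrier) →
                sumᴿ (g ∘ remQuot n) ≈ sumᴿ {m} (λ a → sumᴿ {n} (λ b → g (a , b)))
  sum-remQuot m n g = ≈-trans (sum-combine m {n} (g ∘ remQuot n))
    (≈-reflexive (sumᴿ-cong-≗ λ a → sumᴿ-cong-≗ λ b → cong g (remQuot-combine a b)))

module IntegerSums where
  open import Data.Integer.Base using (_+_; _*_; -_)

  sum-const : ∀ n c → sum {n} (λ _ → c) ≡ + n * c
  sum-const zero c = refl
  sum-const (suc n) c = trans (cong (_+_ c) (sum-const n c)) (sym (ℤₚ.suc-* (+ n) c))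

  sum-*-sum : ∀ {m n} (f : Fin m → ℤ) (g : Fin n → ℤ) → sum f * sum g ≡ sum (λ d → sum (λ e → f d * g e))
  sum-*-sum f g = trans (*-distribʳ-sum (sum g) f) (sum-cong-≗ λ d → *-distribˡ-sum (f d) g)

  sum-supported : ∀ {n} (f : Fin n → ℤ) j → (∀ k → k ≢ j → f k ≡ 0ℤ) → sum f ≡ f j
  sum-supported {suc n} f j f-vanishes = begin
    sum f                            ≡⟨ sum-remove {i = j} f ⟩
    f j + sum (λ k → f (punchIn j k)) ≡⟨ cong (_+_ (f j)) (trans (sum-cong-≗ off-j) (sum-replicate-zero n)) ⟩
    f j + 0ℤ                         ≡⟨ ℤₚ.+-identityʳ (f j) ⟩
    f j                              ∎
    where
    open ≡-Reasoning
    off-j : ∀ k → f (punchIn j k) ≡ 0ℤ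
    off-j k = f-vanishes (punchIn j k) (punchInᵢ≢i j k)

  sum-neg : ∀ {n} (f : Fin n → ℤ) → sum (λ k → - f k) ≡ - sum f
  sum-neg f = trans (sum-cong-≗ λ k → sym (ℤₚ.-1*i≡-i (f k))) (trans (sym (*-distribˡ-sum -1ℤ f)) (ℤₚ.-1*i≡-i (sum f)))

module Indicators where
  open import Data.Integer.Base using (_+_; _*_)
  open import Data.Fin.Properties using (_≟_)
  open IntegerSums using (sum-supported)

  -- Going through `does` makes 𝟙 (suc j ≟ suc k) reduce to 𝟙 (j ≟ k), as Defs.δ does.
  𝟙 : ∀ {a} {A : Set a} → Dec A → ℤ
  𝟙 a? = if does a? then 1ℤ else 0ℤ

  𝟙-true : ∀ {a} {A : Set a} (a? : Dec A) → A → 𝟙 a? ≡ 1ℤ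
  𝟙-true a? x rewrite dec-true a? x = refl

  𝟙-false : ∀ {a} {A : Set a} (a? : Dec A) → ¬ A → 𝟙 a? ≡ 0ℤ
  𝟙-false a? ¬x rewrite dec-false a? ¬x = refl

  module _ {a b} {A : Set a} {B : Set b} where

    𝟙-⇔ : (A → B) → (B → A) → (a? : Dec A) (b? : Dec B) → 𝟙 a? ≡ 𝟙 b?
    𝟙-⇔ to from (yes x) b? = sym (𝟙-true b? (to x))
    𝟙-⇔ to from (no ¬x) b? = sym (𝟙-false b? (¬x ∘ from))

    𝟙-× : (a? : Dec A) (b? : Dec B) → 𝟙 (a? ×-dec b?) ≡ 𝟙 a? * 𝟙 b?
    𝟙-× (yes _) (yes _) = refl
    𝟙-× (yes _) (no _) = refl
    𝟙-× (no _) b? = refl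

  𝟙*-cong : ∀ {a} {A : Set a} (a? : Dec A) {x y} → (A → x ≡ y) → 𝟙 a? * x ≡ 𝟙 a? * y
  𝟙*-cong (yes a) x≡y = cong (1ℤ *_) (x≡y a)
  𝟙*-cong (no _) _ = refl

  𝟙-≟-sym : ∀ {n} (j k : Fin n) → 𝟙 (j ≟ k) ≡ 𝟙 (k ≟ j)
  𝟙-≟-sym j k = 𝟙-⇔ sym sym (j ≟ k) (k ≟ j)

  _≟₂_ : ∀ {a b} → DecidableEquality (Fin a × Fin b)
  _≟₂_ = ≡-dec _≟_ _≟_

  𝟙-≟₂ : ∀ {a b} (u u′ : Fin a) (j j′ : Fin b) → 𝟙 ((u , j) ≟₂ (u′ , j′)) ≡ 𝟙 (u ≟ u′) * 𝟙 (j ≟ j′)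
  𝟙-≟₂ u u′ j j′ = trans
    (𝟙-⇔ (λ eq → ,-injectiveˡ eq , ,-injectiveʳ eq) (λ (e₁ , e₂) → cong₂ _,_ e₁ e₂)
         ((u , j) ≟₂ (u′ , j′)) (u ≟ u′ ×-dec j ≟ j′))
    (𝟙-× (u ≟ u′) (j ≟ j′))

  remQuot-injective : ∀ {a} b {k k′ : Fin (a ℕ.* b)} → remQuot {a} b k ≡ remQuot b k′ → k ≡ k′
  remQuot-injective {a} b {k} {k′} eq =
    trans (sym (combine-remQuot {a} b k)) (trans (cong (uncurry combine) eq) (combine-remQuot {a} b k′))

  𝟙-≟-remQuot : ∀ {a} b (k k′ : Fin (a ℕ.* b)) → 𝟙 (remQuot {a} b k ≟₂ remQuot b k′) ≡ 𝟙 (k ≟ k′)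
  𝟙-≟-remQuot {a} b k k′ = 𝟙-⇔ (remQuot-injective b) (cong (remQuot {a} b)) (remQuot b k ≟₂ remQuot b k′) (k ≟ k′)

  sum-𝟙≟* : ∀ {n} (j : Fin n) (f : Fin n → ℤ) → sum (λ l → 𝟙 (j ≟ l) * f l) ≡ f j
  sum-𝟙≟* j f = trans (sum-supported _ j vanishes) (trans (cong (_* f j) (𝟙-true (j ≟ j) refl)) (ℤₚ.*-identityˡ (f j)))
    where
    vanishes : ∀ l → l ≢ j → 𝟙 (j ≟ l) * f l ≡ 0ℤ
    vanishes l l≢j = cong (_* f l) (𝟙-false (j ≟ l) (l≢j ∘ sym))

  sum-𝟙≟ : ∀ {n} (j : Fin n) → sum (λ l → 𝟙 (j ≟ l)) ≡ 1ℤ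
  sum-𝟙≟ j = trans (sum-cong-≗ (λ l → sym (ℤₚ.*-identityʳ (𝟙 (j ≟ l))))) (sum-𝟙≟* j (λ _ → 1ℤ))

module GaussianIntegers where
  open import Data.Integer.Base using (_+_; _*_; -_; _-_)
  open import Data.Fin.Properties using (_≟_)
  open Indicators using (𝟙)
  open import Algebra.Structures {A = ℤ[i]} _≡_ using (IsCommutativeRing)

  1ᵢ 𝕚 : ℤ[i]
  1ᵢ = 1ℤ + 0ℤ i
  𝕚 = 0ℤ + 1ℤ i

  fromℤ : ℤ → ℤ[i]
  fromℤ a = a + 0ℤ i

  private
    ⊕-assoc : ∀ x y z → (x ⊕ y) ⊕ z ≡ x ⊕ (y ⊕ z)
    ⊕-assoc (a + b i) (c + d i) (e + f i) = cong₂ _+_i (ℤₚ.+-assoc a c e) (ℤₚ.+-assoc b d f)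

    ⊕-comm : ∀ x y → x ⊕ y ≡ y ⊕ x
    ⊕-comm (a + b i) (c + d i) = cong₂ _+_i (ℤₚ.+-comm a c) (ℤₚ.+-comm b d)

    ⊕-identityˡ : ∀ x → 0ᵢ ⊕ x ≡ x
    ⊕-identityˡ (a + b i) = cong₂ _+_i (ℤₚ.+-identityˡ a) (ℤₚ.+-identityˡ b)

    ⊝-inverseˡ : ∀ x → ⊝ x ⊕ x ≡ 0ᵢ
    ⊝-inverseˡ (a + b i) = cong₂ _+_i (ℤₚ.+-inverseˡ a) (ℤₚ.+-inverseˡ b)

    ⊗-assoc : ∀ x y z → (x ⊗ y) ⊗ z ≡ x ⊗ (y ⊗ z)
    ⊗-assoc (a + b i) (c + d i) (e + f i) = cong₂ _+_i (re-assoc a b c d e f) (im-assoc a b c d e f)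
      where
      re-assoc : ∀ a b c d e f → (a * c - b * d) * e - (a * d + b * c) * f ≡ a * (c * e - d * f) - b * (c * f + d * e)
      re-assoc = solve-∀
      im-assoc : ∀ a b c d e f → (a * c - b * d) * f + (a * d + b * c) * e ≡ a * (c * f + d * e) + b * (c * e - d * f)
      im-assoc = solve-∀

    ⊗-comm : ∀ x y → x ⊗ y ≡ y ⊗ x
    ⊗-comm (a + b i) (c + d i) = cong₂ _+_i (re-comm a b c d) (im-comm a b c d)
      where
      re-comm : ∀ a b c d → a * c - b * d ≡ c * a - d * b
      re-comm = solve-∀
      im-comm : ∀ a b c d → a * d + b * c ≡ c * b + d * a
      im-comm = solve-∀

    ⊗-identityˡ : ∀ x → 1ᵢ ⊗ x ≡ x
    ⊗-identityˡ (a + b i) = cong₂ _+_i (re-identity a b) (im-identity a b)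
      where
      re-identity : ∀ a b → 1ℤ * a - 0ℤ * b ≡ a
      re-identity = solve-∀
      im-identity : ∀ a b → 1ℤ * b + 0ℤ * a ≡ b
      im-identity = solve-∀

    ⊗-distribˡ : ∀ x y z → x ⊗ (y ⊕ z) ≡ x ⊗ y ⊕ x ⊗ z
    ⊗-distribˡ (a + b i) (c + d i) (e + f i) = cong₂ _+_i (re-distrib a b c d e f) (im-distrib a b c d e f)
      where
      re-distrib : ∀ a b c d e f → a * (c + e) - b * (d + f) ≡ (a * c - b * d) + (a * e - b * f)
      re-distrib = solve-∀
      im-distrib : ∀ a b c d e f → a * (d + f) + b * (c + e) ≡ (a * d + b * c) + (a * f + b * e)
      im-distrib = solve-∀

  ℤ[i]-isCommutativeRing : IsCommutativeRing _⊕_ _⊗_ ⊝_ 0ᵢ 1ᵢ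
  ℤ[i]-isCommutativeRing = record
    { isRing = record
      { +-isAbelianGroup = record
        { isGroup = record
          { isMonoid = record
            { isSemigroup = record
              { isMagma = record { isEquivalence = isEquivalence ; ∙-cong = cong₂ _⊕_ }
              ; assoc = ⊕-assoc
              }
            ; identity = ⊕-identityˡ , comm∧idˡ⇒idʳ ⊕-comm ⊕-identityˡ
            }
          ; inverse = ⊝-inverseˡ , comm∧invˡ⇒invʳ ⊕-comm ⊝-inverseˡ
          ; ⁻¹-cong = cong ⊝_
          }
        ; comm = ⊕-comm
        }
      ; *-cong = cong₂ _⊗_
      ; *-assoc = ⊗-assoc
      ; *-identity = ⊗-identityˡ , comm∧idˡ⇒idʳ ⊗-comm ⊗-identityˡ
      ; distrib = ⊗-distribˡ , comm∧distrˡ⇒distrʳ ⊗-comm ⊗-distribˡ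
      }
    ; *-comm = ⊗-comm
    }

  ℤ[i]-commutativeRing : CommutativeRing _ _
  ℤ[i]-commutativeRing = record { isCommutativeRing = ℤ[i]-isCommutativeRing }

  ℤ[i]-almostCommutativeRing : AlmostCommutativeRing _ _
  ℤ[i]-almostCommutativeRing = fromCommutativeRing ℤ[i]-commutativeRing λ
    { ((+ 0) + (+ 0) i) → just refl
    ; _ → nothing
    }

  module ℤ[i]-Solver = NonReflective ℤ[i]-almostCommutativeRing

  open SemiringSum (CommutativeRing.semiring ℤ[i]-commutativeRing) public
    using () renaming (sum to sumᵢ; sum-cong-≗ to sumᵢ-cong-≗; ∑-distrib-+ to sumᵢ-distrib-+;
                       *-distribˡ-sum to ⊗-distribˡ-sumᵢ; *-distribʳ-sum to ⊗-distribʳ-sumᵢ)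

  ∑≡sumᵢ : ∀ n (f : Fin n → ℤ[i]) → ∑ n f ≡ sumᵢ f
  ∑≡sumᵢ zero f = refl
  ∑≡sumᵢ (suc n) f = cong (f zero ⊕_) (∑≡sumᵢ n (f ∘ suc))

  conj-⊕ : ∀ x y → conj (x ⊕ y) ≡ conj x ⊕ conj y
  conj-⊕ (a + b i) (c + d i) = cong (_+_i (a + c)) (ℤₚ.neg-distrib-+ b d)

  conj-⊗ : ∀ x y → conj (x ⊗ y) ≡ conj x ⊗ conj y
  conj-⊗ (a + b i) (c + d i) = cong₂ _+_i (re-conj a b c d) (im-conj a b c d)
    where
    re-conj : ∀ a b c d → a * c - b * d ≡ a * c - (- b) * (- d)
    re-conj = solve-∀
    im-conj : ∀ a b c d → - (a * d + b * c) ≡ a * (- d) + (- b) * c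
    im-conj = solve-∀

  fromℤ-* : ∀ a b → fromℤ (a * b) ≡ fromℤ a ⊗ fromℤ b
  fromℤ-* a b = cong₂ _+_i (re-* a b) (im-* a b)
    where
    re-* : ∀ a b → a * b ≡ a * b - 0ℤ * 0ℤ
    re-* = solve-∀
    im-* : ∀ a b → 0ℤ ≡ a * 0ℤ + 0ℤ * b
    im-* = solve-∀

  fromℤ-sum : ∀ {n} (f : Fin n → ℤ) → sumᵢ (fromℤ ∘ f) ≡ fromℤ (sum f)
  fromℤ-sum {zero} f = refl
  fromℤ-sum {suc n} f = cong (fromℤ (f zero) ⊕_) (fromℤ-sum (f ∘ suc))

  fromℤ⊕𝕚⊗fromℤ : ∀ a b → fromℤ a ⊕ 𝕚 ⊗ fromℤ b ≡ a + b i
  fromℤ⊕𝕚⊗fromℤ a b = cong₂ _+_i (re-part a b) (im-part a b)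
    where
    re-part : ∀ a b → a + (0ℤ * b - 1ℤ * 0ℤ) ≡ a
    re-part = solve-∀
    im-part : ∀ a b → 0ℤ + (0ℤ * 0ℤ + 1ℤ * b) ≡ b
    im-part = solve-∀

  conj-real-combination : ∀ x y a b → conj (x ⊗ fromℤ a ⊕ y ⊗ fromℤ b) ≡ conj x ⊗ fromℤ a ⊕ conj y ⊗ fromℤ b
  conj-real-combination x y a b =
    trans (conj-⊕ (x ⊗ fromℤ a) (y ⊗ fromℤ b)) (cong₂ _⊕_ (conj-⊗ x (fromℤ a)) (conj-⊗ y (fromℤ b)))

  sumᵢ-scale : ∀ {n} c (f : Fin n → ℤ) → sumᵢ (λ l → c ⊗ fromℤ (f l)) ≡ c ⊗ fromℤ (sum f)
  sumᵢ-scale c f = trans (sym (⊗-distribˡ-sumᵢ c (fromℤ ∘ f))) (cong (c ⊗_) (fromℤ-sum f))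

  sumᵢ-linear : ∀ {n} a b (f g : Fin n → ℤ) →
                sumᵢ (λ l → a ⊗ fromℤ (f l) ⊕ b ⊗ fromℤ (g l)) ≡ a ⊗ fromℤ (sum f) ⊕ b ⊗ fromℤ (sum g)
  sumᵢ-linear a b f g = trans (sumᵢ-distrib-+ (λ l → a ⊗ fromℤ (f l)) (λ l → b ⊗ fromℤ (g l)))
                              (cong₂ _⊕_ (sumᵢ-scale a f) (sumᵢ-scale b g))

  sumᵢ-bilinear : ∀ {n} α β γ ζ (u v u′ v′ : Fin n → ℤ) →
    sumᵢ (λ l → (α ⊗ fromℤ (u l) ⊕ β ⊗ fromℤ (v l)) ⊗ (γ ⊗ fromℤ (u′ l) ⊕ ζ ⊗ fromℤ (v′ l)))
      ≡ (α ⊗ γ ⊗ fromℤ (sum (λ l → u l * u′ l)) ⊕ α ⊗ ζ ⊗ fromℤ (sum (λ l → u l * v′ l)))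
        ⊕ (β ⊗ γ ⊗ fromℤ (sum (λ l → v l * u′ l)) ⊕ β ⊗ ζ ⊗ fromℤ (sum (λ l → v l * v′ l)))
  sumᵢ-bilinear α β γ ζ u v u′ v′ = begin
    sumᵢ (λ l → (α ⊗ fromℤ (u l) ⊕ β ⊗ fromℤ (v l)) ⊗ (γ ⊗ fromℤ (u′ l) ⊕ ζ ⊗ fromℤ (v′ l)))
      ≡⟨ sumᵢ-cong-≗ (λ l → expand (u l) (v l) (u′ l) (v′ l)) ⟩
    sumᵢ (λ l → (α ⊗ γ ⊗ fromℤ (u l * u′ l) ⊕ α ⊗ ζ ⊗ fromℤ (u l * v′ l))
                ⊕ (β ⊗ γ ⊗ fromℤ (v l * u′ l) ⊕ β ⊗ ζ ⊗ fromℤ (v l * v′ l)))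
      ≡⟨ sumᵢ-distrib-+ (λ l → α ⊗ γ ⊗ fromℤ (u l * u′ l) ⊕ α ⊗ ζ ⊗ fromℤ (u l * v′ l))
                        (λ l → β ⊗ γ ⊗ fromℤ (v l * u′ l) ⊕ β ⊗ ζ ⊗ fromℤ (v l * v′ l)) ⟩
    sumᵢ (λ l → α ⊗ γ ⊗ fromℤ (u l * u′ l) ⊕ α ⊗ ζ ⊗ fromℤ (u l * v′ l))
      ⊕ sumᵢ (λ l → β ⊗ γ ⊗ fromℤ (v l * u′ l) ⊕ β ⊗ ζ ⊗ fromℤ (v l * v′ l))
      ≡⟨ cong₂ _⊕_ (sumᵢ-linear (α ⊗ γ) (α ⊗ ζ) (λ l → u l * u′ l) (λ l → u l * v′ l))
                   (sumᵢ-linear (β ⊗ γ) (β ⊗ ζ) (λ l → v l * u′ l) (λ l → v l * v′ l)) ⟩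
    (α ⊗ γ ⊗ fromℤ (sum (λ l → u l * u′ l)) ⊕ α ⊗ ζ ⊗ fromℤ (sum (λ l → u l * v′ l)))
      ⊕ (β ⊗ γ ⊗ fromℤ (sum (λ l → v l * u′ l)) ⊕ β ⊗ ζ ⊗ fromℤ (sum (λ l → v l * v′ l))) ∎
    where
    open ≡-Reasoning
    open ℤ[i]-Solver using (solve; _⊜_) renaming (_⊕_ to _:+_; _⊗_ to _:*_)
    ring-expand : ∀ α β γ ζ a b c d → (α ⊗ a ⊕ β ⊗ b) ⊗ (γ ⊗ c ⊕ ζ ⊗ d)
                  ≡ (α ⊗ γ ⊗ (a ⊗ c) ⊕ α ⊗ ζ ⊗ (a ⊗ d)) ⊕ (β ⊗ γ ⊗ (b ⊗ c) ⊕ β ⊗ ζ ⊗ (b ⊗ d))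
    ring-expand = solve 8 (λ α β γ ζ a b c d → ((α :* a :+ β :* b) :* (γ :* c :+ ζ :* d))
                            ⊜ ((α :* γ :* (a :* c) :+ α :* ζ :* (a :* d)) :+ (β :* γ :* (b :* c) :+ β :* ζ :* (b :* d)))) refl
    expand : ∀ a b c d → (α ⊗ fromℤ a ⊕ β ⊗ fromℤ b) ⊗ (γ ⊗ fromℤ c ⊕ ζ ⊗ fromℤ d)
             ≡ (α ⊗ γ ⊗ fromℤ (a * c) ⊕ α ⊗ ζ ⊗ fromℤ (a * d))
               ⊕ (β ⊗ γ ⊗ fromℤ (b * c) ⊕ β ⊗ ζ ⊗ fromℤ (b * d))
    expand a b c d = trans (ring-expand α β γ ζ (fromℤ a) (fromℤ b) (fromℤ c) (fromℤ d))
      (sym (cong₂ _⊕_ (cong₂ _⊕_ (cong (α ⊗ γ ⊗_) (fromℤ-* a c)) (cong (α ⊗ ζ ⊗_) (fromℤ-* a d)))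
                      (cong₂ _⊕_ (cong (β ⊗ γ ⊗_) (fromℤ-* b c)) (cong (β ⊗ ζ ⊗_) (fromℤ-* b d)))))

  δ≡fromℤ𝟙 : ∀ {n} (j k : Fin n) → δ j k ≡ fromℤ (𝟙 (j ≟ k))
  δ≡fromℤ𝟙 zero zero = refl
  δ≡fromℤ𝟙 zero (suc k) = refl
  δ≡fromℤ𝟙 (suc j) zero = refl
  δ≡fromℤ𝟙 (suc j) (suc k) = δ≡fromℤ𝟙 j k

module LinearCongruence (p : ℕ) (p-prime : Prime p) where
  open import Data.Integer.Base using (_+_; _*_; -_; _-_; ∣_∣)
  open import Data.Integer.Divisibility.Signed
    using (_∣_; _∣?_; divides; ∣⇒∣ᵤ; ∣ᵤ⇒∣; ∣m⇒∣-m; ∣m∣n⇒∣m+n; ∣m∣n⇒∣m-n; ∣n⇒∣m*n; ∣m⇒∣m*n)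
  open import Data.Integer.DivMod using (_%ℕ_; _/ℕ_; a≡a%ℕn+[a/ℕn]*n; n%ℕd<d)
  open import Data.Fin.Base using (fromℕ<)
  open import Data.Fin.Properties using (_≟_; toℕ-injective; toℕ<n; toℕ-fromℕ<)
  open import Data.Nat.Coprimality using (Coprime; prime⇒coprime; coprime-Bézout)
  import Data.Nat.Coprimality as Coprimality
  open import Data.Nat.GCD using (module Bézout)
  open Indicators

  instance
    p-nonZero : ℕ.NonZero p
    p-nonZero = prime⇒nonZero p-prime

  ι : Fin p → ℤ
  ι s = + toℕ s

  [p∣_] : ℤ → ℤ
  [p∣ c ] = 𝟙 (+ p ∣? c)

  private
    neg-diff : ∀ a b → - (a - b) ≡ b - a
    neg-diff = solve-∀

    diff+ : ∀ a b → (a - b) + b ≡ a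
    diff+ = solve-∀

  p∣0 : + p ∣ 0ℤ
  p∣0 = divides 0ℤ refl

  p∤1 : ¬ + p ∣ 1ℤ
  p∤1 p∣1 = ℕ.nonTrivial⇒≢1 {{prime⇒nonTrivial p-prime}} (ℕ∣.∣1⇒≡1 (∣⇒∣ᵤ p∣1))

  ∣-diff-sym : ∀ {a b} → + p ∣ a - b → + p ∣ b - a
  ∣-diff-sym {a} {b} p∣a-b = subst (+ p ∣_) (neg-diff a b) (∣m⇒∣-m p∣a-b)

  [p∣]-⇔ : ∀ {a b} → (+ p ∣ a → + p ∣ b) → (+ p ∣ b → + p ∣ a) → [p∣ a ] ≡ [p∣ b ]
  [p∣]-⇔ {a} {b} to from = 𝟙-⇔ to from (+ p ∣? a) (+ p ∣? b)

  [p∣0] : [p∣ 0ℤ ] ≡ 1ℤ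
  [p∣0] = 𝟙-true (+ p ∣? 0ℤ) p∣0

  [p∣-] : ∀ a → [p∣ - a ] ≡ [p∣ a ]
  [p∣-] a = [p∣]-⇔ (λ p∣-a → subst (+ p ∣_) (ℤₚ.neg-involutive a) (∣m⇒∣-m p∣-a)) ∣m⇒∣-m

  [p∣]-* : ∀ a b → [p∣ a ] * [p∣ b ] ≡ [p∣ a ] * [p∣ b - a ]
  [p∣]-* a b = 𝟙*-cong (+ p ∣? a) λ p∣a →
    [p∣]-⇔ (λ p∣b → ∣m∣n⇒∣m-n p∣b p∣a) (λ p∣b-a → subst (+ p ∣_) (diff+ b a) (∣m∣n⇒∣m+n p∣b-a p∣a))

  private
    divisible-below-p : ∀ {d} → p ℕ∣.∣ d → d ℕ.< p → d ≡ 0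
    divisible-below-p {zero} _ _ = refl
    divisible-below-p {suc d} p∣d d<p = contradiction (ℕ∣.∣⇒≤ p∣d) (ℕₚ.<⇒≱ d<p)

    ι-injective-≤ : ∀ {s t} → toℕ t ℕ.≤ toℕ s → + p ∣ ι s - ι t → s ≡ t
    ι-injective-≤ {s} {t} t≤s p∣s-t = toℕ-injective (ℕₚ.≤-antisym (ℕₚ.m∸n≡0⇒m≤n s∸t≡0) t≤s)
      where
      ι-diff : ι s - ι t ≡ + (toℕ s ℕ.∸ toℕ t)
      ι-diff = trans (ℤₚ.m-n≡m⊖n (toℕ s) (toℕ t)) (ℤₚ.⊖-≥ t≤s)
      s∸t≡0 : toℕ s ℕ.∸ toℕ t ≡ 0
      s∸t≡0 = divisible-below-p (∣⇒∣ᵤ (subst (+ p ∣_) ι-diff p∣s-t))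
                                (ℕₚ.≤-<-trans (ℕₚ.m∸n≤m (toℕ s) (toℕ t)) (toℕ<n s))

  ι-injective : ∀ {s t} → + p ∣ ι s - ι t → s ≡ t
  ι-injective {s} {t} p∣s-t with ℕₚ.≤-total (toℕ t) (toℕ s)
  ... | inj₁ t≤s = ι-injective-≤ {s} {t} t≤s p∣s-t
  ... | inj₂ s≤t = sym (ι-injective-≤ {t} {s} s≤t (∣-diff-sym {ι s} {ι t} p∣s-t))

  [p∣ι-ι] : ∀ s t → [p∣ ι s - ι t ] ≡ 𝟙 (t ≟ s)
  [p∣ι-ι] s t = 𝟙-⇔ (sym ∘ ι-injective) (λ { refl → subst (+ p ∣_) (sym (ℤₚ.+-inverseʳ (ι s))) p∣0 })
                    (+ p ∣? ι s - ι t) (t ≟ s)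

  euclid : ∀ {a b} → ¬ + p ∣ a → + p ∣ a * b → + p ∣ b
  euclid {a} {b} p∤a p∣ab with euclidsLemma ∣ a ∣ ∣ b ∣ p-prime (subst (p ℕ∣.∣_) (ℤₚ.abs-* a b) (∣⇒∣ᵤ p∣ab))
  ... | inj₁ p∣a = contradiction (∣ᵤ⇒∣ p∣a) p∤a
  ... | inj₂ p∣b = ∣ᵤ⇒∣ p∣b

  residue : ℤ → Fin p
  residue c = fromℕ< (n%ℕd<d c p)

  residue-correct : ∀ c → + p ∣ c - ι (residue c)
  residue-correct c = divides (c /ℕ p) (begin
    c - ι (residue c)                         ≡⟨ cong (λ r → c - + r) (toℕ-fromℕ< (n%ℕd<d c p)) ⟩
    c - + (c %ℕ p)                            ≡⟨ cong (_- + (c %ℕ p)) (a≡a%ℕn+[a/ℕn]*n c p) ⟩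
    + (c %ℕ p) + (c /ℕ p) * + p - + (c %ℕ p)  ≡⟨ cancel (+ (c %ℕ p)) ((c /ℕ p) * + p) ⟩
    (c /ℕ p) * + p                            ∎)
    where
    open ≡-Reasoning
    cancel : ∀ r q → r + q - r ≡ q
    cancel = solve-∀

  private
    Bézout-in-ℤ : ∀ a b c d → 1 ℕ.+ a ℕ.* b ≡ c ℕ.* d → 1ℤ + + a * + b ≡ + c * + d
    Bézout-in-ℤ a b c d eq = begin
      1ℤ + + a * + b  ≡⟨ cong (_+_ 1ℤ) (sym (ℤₚ.pos-* a b)) ⟩
      + (1 ℕ.+ a ℕ.* b) ≡⟨ cong +_ eq ⟩
      + (c ℕ.* d)     ≡⟨ ℤₚ.pos-* c d ⟩
      + c * + d       ∎
      where open ≡-Reasoning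

    inverse-from-+- : ∀ r x y q → 1ℤ + y * q ≡ x * r → r * x - 1ℤ ≡ y * q
    inverse-from-+- r x y q eq = trans (cong (_- 1ℤ) (trans (ℤₚ.*-comm r x) (sym eq))) (cancel (y * q))
      where
      cancel : ∀ t → 1ℤ + t - 1ℤ ≡ t
      cancel = solve-∀

    inverse-from--+ : ∀ r x y q → 1ℤ + x * r ≡ y * q → r * (- x) - 1ℤ ≡ (- y) * q
    inverse-from--+ r x y q eq = trans (rearrange r x) (trans (cong -_ eq) (ℤₚ.neg-distribˡ-* y q))
      where
      rearrange : ∀ r x → r * (- x) - 1ℤ ≡ - (1ℤ + x * r)
      rearrange = solve-∀

  inverse-of-coprime : ∀ {r} → Coprime r p → ∃[ u ] + p ∣ + r * u - 1ℤ
  inverse-of-coprime {r} r⊥p with coprime-Bézout r⊥p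
  ... | Bézout.+- x y eq = + x , divides (+ y) (inverse-from-+- (+ r) (+ x) (+ y) (+ p) (Bézout-in-ℤ y p x r eq))
  ... | Bézout.-+ x y eq = - + x , divides (- + y) (inverse-from--+ (+ r) (+ x) (+ y) (+ p) (Bézout-in-ℤ x r y p eq))

  residue-nonZero : ∀ {a} → ¬ + p ∣ a → ℕ.NonZero (toℕ (residue a))
  residue-nonZero {a} p∤a = ℕ.≢-nonZero λ r≡0 →
    p∤a (subst (+ p ∣_) (trans (cong (λ r → a - + r) r≡0) (ℤₚ.+-identityʳ a)) (residue-correct a))

  inverse : ∀ {a} → ¬ + p ∣ a → ∃[ u ] + p ∣ a * u - 1ℤ
  inverse {a} p∤a = u , subst (+ p ∣_) (split a (ι (residue a)) u) (∣m∣n⇒∣m+n (∣m⇒∣m*n u (residue-correct a)) p∣ru-1)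
    where
    r⊥p : Coprime (toℕ (residue a)) p
    r⊥p = Coprimality.sym (prime⇒coprime p-prime {{residue-nonZero p∤a}} (toℕ<n (residue a)))
    u : ℤ
    u = proj₁ (inverse-of-coprime r⊥p)
    p∣ru-1 : + p ∣ ι (residue a) * u - 1ℤ
    p∣ru-1 = proj₂ (inverse-of-coprime r⊥p)
    split : ∀ a r u → (a - r) * u + (r * u - 1ℤ) ≡ a * u - 1ℤ
    split = solve-∀

  linear-root : ∀ {a} → ¬ + p ∣ a → ∀ c → ∃[ s₀ ] ∀ s → [p∣ a * ι s - c ] ≡ 𝟙 (s₀ ≟ s)
  linear-root {a} p∤a c = s₀ , λ s → 𝟙-⇔ (unique s) (λ { refl → root }) (+ p ∣? a * ι s - c) (s₀ ≟ s)
    where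
    u : ℤ
    u = proj₁ (inverse p∤a)
    s₀ : Fin p
    s₀ = residue (u * c)
    rearrange : ∀ a u c r → (a * u - 1ℤ) * c - a * (u * c - r) ≡ a * r - c
    rearrange = solve-∀
    factor : ∀ a r s c → (a * r - c) - (a * s - c) ≡ a * (r - s)
    factor = solve-∀
    root : + p ∣ a * ι s₀ - c
    root = subst (+ p ∣_) (rearrange a u c (ι s₀))
      (∣m∣n⇒∣m-n (∣m⇒∣m*n c (proj₂ (inverse p∤a))) (∣n⇒∣m*n a (residue-correct (u * c))))
    unique : ∀ s → + p ∣ a * ι s - c → s₀ ≡ s
    unique s p∣ = ι-injective (euclid p∤a (subst (+ p ∣_) (factor a (ι s₀) (ι s) c) (∣m∣n⇒∣m-n root p∣)))

  linear-congruence-count : ∀ {a} → ¬ + p ∣ a → ∀ c → sum (λ s → [p∣ a * ι s - c ]) ≡ 1ℤ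
  linear-congruence-count p∤a c = trans (sum-cong-≗ (proj₂ (linear-root p∤a c))) (sum-𝟙≟ (proj₁ (linear-root p∤a c)))

  congruence-count : ∀ c → sum (λ s → [p∣ ι s - c ]) ≡ 1ℤ
  congruence-count c = trans (sum-cong-≗ λ s → cong (λ x → [p∣ x - c ]) (sym (ℤₚ.*-identityˡ (ι s))))
                             (linear-congruence-count p∤1 c)

  congruence-pair-count : ∀ c c′ → sum (λ s → [p∣ ι s - c ] * [p∣ ι s - c′ ]) ≡ [p∣ c - c′ ]
  congruence-pair-count c c′ = begin
    sum (λ s → [p∣ ι s - c ] * [p∣ ι s - c′ ])  ≡⟨ sum-cong-≗ same-residue ⟩
    sum (λ s → [p∣ ι s - c ] * [p∣ c - c′ ])    ≡⟨ sym (*-distribʳ-sum [p∣ c - c′ ] (λ s → [p∣ ι s - c ])) ⟩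
    sum (λ s → [p∣ ι s - c ]) * [p∣ c - c′ ]     ≡⟨ cong (_* [p∣ c - c′ ]) (congruence-count c) ⟩
    1ℤ * [p∣ c - c′ ]                            ≡⟨ ℤₚ.*-identityˡ _ ⟩
    [p∣ c - c′ ]                                 ∎
    where
    open ≡-Reasoning
    shift : ∀ x c c′ → (x - c′) - (x - c) ≡ c - c′
    shift = solve-∀
    same-residue : ∀ s → [p∣ ι s - c ] * [p∣ ι s - c′ ] ≡ [p∣ ι s - c ] * [p∣ c - c′ ]
    same-residue s = trans ([p∣]-* (ι s - c) (ι s - c′)) (cong (λ x → [p∣ ι s - c ] * [p∣ x ]) (shift (ι s) c c′))

module AffinePlane (p : ℕ) (p-prime : Prime p) where
  open import Data.Integer.Base using (_+_; _*_; -_; _-_)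
  open import Data.Integer.Divisibility.Signed using (_∣_)
  open import Data.Fin.Properties using (_≟_)
  open IntegerSums
  open Indicators
  open LinearCongruence p p-prime

  Point : Set
  Point = Fin p × Fin p

  -- A sum over Fin (p * p), so that sums over the indices of a matrix indexed by remQuot are literally ∑ₚ.
  ∑ₚ : (Point → ℤ) → ℤ
  ∑ₚ f = sum (f ∘ remQuot p)

  ∑ₚ-as-double-sum : ∀ f → ∑ₚ f ≡ sum (λ a → sum (λ b → f (a , b)))
  ∑ₚ-as-double-sum = FiniteSums.sum-remQuot ℤₚ.+-*-semiring p p

  ∑ₚ-sum-comm : ∀ {n} (f : Fin n → Point → ℤ) → ∑ₚ (λ y → sum (λ d → f d y)) ≡ sum (λ d → ∑ₚ (f d))
  ∑ₚ-sum-comm f = ∑-comm (λ k d → f d (remQuot p k))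

  ∑ₚ-*ˡ : ∀ c (f : Point → ℤ) → ∑ₚ (λ y → c * f y) ≡ c * ∑ₚ f
  ∑ₚ-*ˡ c f = sym (*-distribˡ-sum c (f ∘ remQuot p))

  Direction : Set
  Direction = Fin (suc p)

  -- Lines of direction zero are the verticals a ≡ c, those of direction suc s are b ≡ s a + c.
  φ : Direction → Point → ℤ
  φ zero (a , b) = ι a
  φ (suc s) (a , b) = ι b - ι s * ι a

  line : Direction → Point → Point → ℤ
  line d x y = [p∣ φ d y - φ d x ]

  private
    φ-suc : ∀ b s a c → b - s * a - c ≡ b - (s * a + c)
    φ-suc = solve-∀

  line-sym : ∀ d x y → line d x y ≡ line d y x
  line-sym d x y = trans (cong [p∣_] (sym (neg-diff (φ d x) (φ d y)))) ([p∣-] (φ d x - φ d y))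
    where
    neg-diff : ∀ a b → - (a - b) ≡ b - a
    neg-diff = solve-∀

  line-refl : ∀ d x → line d x x ≡ 1ℤ
  line-refl d x = trans (cong [p∣_] (ℤₚ.+-inverseʳ (φ d x))) [p∣0]

  private
    one-per-vertical : ∀ s a c → sum (λ b → [p∣ ι b - ι s * ι a - c ]) ≡ 1ℤ
    one-per-vertical s a c = trans (sum-cong-≗ λ b → cong [p∣_] (φ-suc (ι b) (ι s) (ι a) c)) (congruence-count (ι s * ι a + c))

  level-size : ∀ d c → ∑ₚ (λ y → [p∣ φ d y - c ]) ≡ + p
  level-size zero c = begin
    ∑ₚ (λ y → [p∣ φ zero y - c ])           ≡⟨ ∑ₚ-as-double-sum (λ y → [p∣ φ zero y - c ]) ⟩
    sum (λ a → sum {p} (λ _ → [p∣ ι a - c ])) ≡⟨ sum-cong-≗ (λ a → sum-const p [p∣ ι a - c ]) ⟩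
    sum (λ a → + p * [p∣ ι a - c ])         ≡⟨ *-distribˡ-sum (+ p) (λ a → [p∣ ι a - c ]) ⟨
    + p * sum (λ a → [p∣ ι a - c ])         ≡⟨ cong (+ p *_) (congruence-count c) ⟩
    + p * 1ℤ                                ≡⟨ ℤₚ.*-identityʳ (+ p) ⟩
    + p                                     ∎
    where open ≡-Reasoning
  level-size (suc s) c = begin
    ∑ₚ (λ y → [p∣ φ (suc s) y - c ])                   ≡⟨ ∑ₚ-as-double-sum (λ y → [p∣ φ (suc s) y - c ]) ⟩
    sum (λ a → sum (λ b → [p∣ ι b - ι s * ι a - c ]))  ≡⟨ sum-cong-≗ (λ a → one-per-vertical s a c) ⟩
    sum {p} (λ _ → 1ℤ)                                 ≡⟨ sum-const p 1ℤ ⟩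
    + p * 1ℤ                                           ≡⟨ ℤₚ.*-identityʳ (+ p) ⟩
    + p                                                ∎
    where open ≡-Reasoning

  level-pair : ∀ d c c′ → ∑ₚ (λ y → [p∣ φ d y - c ] * [p∣ φ d y - c′ ]) ≡ + p * [p∣ c - c′ ]
  level-pair d c c′ = begin
    ∑ₚ (λ y → [p∣ φ d y - c ] * [p∣ φ d y - c′ ])  ≡⟨ sum-cong-≗ (λ k → same-level (φ d (remQuot p k))) ⟩
    ∑ₚ (λ y → [p∣ φ d y - c ] * [p∣ c - c′ ])
      ≡⟨ *-distribʳ-sum [p∣ c - c′ ] (λ k → [p∣ φ d (remQuot p k) - c ]) ⟨
    ∑ₚ (λ y → [p∣ φ d y - c ]) * [p∣ c - c′ ]      ≡⟨ cong (_* [p∣ c - c′ ]) (level-size d c) ⟩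
    + p * [p∣ c - c′ ]                             ∎
    where
    open ≡-Reasoning
    shift : ∀ x c c′ → (x - c′) - (x - c) ≡ c - c′
    shift = solve-∀
    same-level : ∀ x → [p∣ x - c ] * [p∣ x - c′ ] ≡ [p∣ x - c ] * [p∣ c - c′ ]
    same-level x = trans ([p∣]-* (x - c) (x - c′)) (cong (λ z → [p∣ x - c ] * [p∣ z ]) (shift x c c′))

  levels-meet : ∀ {d e} → d ≢ e → ∀ c c′ → ∑ₚ (λ y → [p∣ φ d y - c ] * [p∣ φ e y - c′ ]) ≡ 1ℤ
  levels-meet {zero} {zero} d≢e c c′ = contradiction refl d≢e
  levels-meet {zero} {suc t} _ c c′ = begin
    ∑ₚ (λ y → [p∣ φ zero y - c ] * [p∣ φ (suc t) y - c′ ])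
      ≡⟨ ∑ₚ-as-double-sum (λ y → [p∣ φ zero y - c ] * [p∣ φ (suc t) y - c′ ]) ⟩
    sum (λ a → sum (λ b → [p∣ ι a - c ] * [p∣ ι b - ι t * ι a - c′ ]))
      ≡⟨ sum-cong-≗ (λ a → *-distribˡ-sum [p∣ ι a - c ] (λ b → [p∣ ι b - ι t * ι a - c′ ])) ⟨
    sum (λ a → [p∣ ι a - c ] * sum (λ b → [p∣ ι b - ι t * ι a - c′ ]))
      ≡⟨ sum-cong-≗ (λ a → trans (cong ([p∣ ι a - c ] *_) (one-per-vertical t a c′)) (ℤₚ.*-identityʳ [p∣ ι a - c ])) ⟩
    sum (λ a → [p∣ ι a - c ])
      ≡⟨ congruence-count c ⟩
    1ℤ ∎
    where open ≡-Reasoning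
  levels-meet {suc s} {zero} _ c c′ =
    trans (sum-cong-≗ λ k → ℤₚ.*-comm [p∣ φ (suc s) (remQuot p k) - c ] [p∣ φ zero (remQuot p k) - c′ ])
          (levels-meet {zero} {suc s} (λ ()) c′ c)
  levels-meet {suc s} {suc t} s≢t c c′ = begin
    ∑ₚ (λ y → [p∣ φ (suc s) y - c ] * [p∣ φ (suc t) y - c′ ])
      ≡⟨ ∑ₚ-as-double-sum (λ y → [p∣ φ (suc s) y - c ] * [p∣ φ (suc t) y - c′ ]) ⟩
    sum (λ a → sum (λ b → [p∣ ι b - ι s * ι a - c ] * [p∣ ι b - ι t * ι a - c′ ]))
      ≡⟨ sum-cong-≗ (λ a → meet-on-vertical a) ⟩
    sum (λ a → [p∣ (ι s * ι a + c) - (ι t * ι a + c′) ])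
      ≡⟨ sum-cong-≗ (λ a → cong [p∣_] (collect (ι s) (ι t) (ι a) c c′)) ⟩
    sum (λ a → [p∣ (ι s - ι t) * ι a - (c′ - c) ])
      ≡⟨ linear-congruence-count slopes-differ (c′ - c) ⟩
    1ℤ ∎
    where
    open ≡-Reasoning
    collect : ∀ s t a c c′ → (s * a + c) - (t * a + c′) ≡ (s - t) * a - (c′ - c)
    collect = solve-∀
    slopes-differ : ¬ + p ∣ ι s - ι t
    slopes-differ = s≢t ∘ cong suc ∘ ι-injective
    meet-on-vertical : ∀ a → sum (λ b → [p∣ ι b - ι s * ι a - c ] * [p∣ ι b - ι t * ι a - c′ ])
                             ≡ [p∣ (ι s * ι a + c) - (ι t * ι a + c′) ]
    meet-on-vertical a = trans
      (sum-cong-≗ λ b → cong₂ (λ x y → [p∣ x ] * [p∣ y ]) (φ-suc (ι b) (ι s) (ι a) c) (φ-suc (ι b) (ι t) (ι a) c′))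
      (congruence-pair-count (ι s * ι a + c) (ι t * ι a + c′))

  line-intersection : ∀ d e x x′ → ∑ₚ (λ y → line d x y * line e x′ y) ≡ 1ℤ + 𝟙 (d ≟ e) * (+ p * line d x x′ - 1ℤ)
  line-intersection d e x x′ with d ≟ e
  ... | yes refl = trans (level-pair d (φ d x) (φ d x′)) (trans (cong (+ p *_) (line-sym d x′ x)) (expand (+ p * line d x x′)))
    where
    expand : ∀ t → t ≡ 1ℤ + 1ℤ * (t - 1ℤ)
    expand = solve-∀
  ... | no d≢e = levels-meet d≢e (φ d x) (φ e x′)

  line-through-distinct : ∀ {x y} → x ≢ y → ∃[ d₀ ] ∀ d → line d x y ≡ 𝟙 (d₀ ≟ d)
  line-through-distinct {a , b} {a′ , b′} x≢y with a ≟ a′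
  ... | yes refl = zero , vertical
    where
    cancel : ∀ b′ b t → (b′ - t) - (b - t) ≡ b′ - b
    cancel = solve-∀
    vertical : ∀ d → line d (a , b) (a , b′) ≡ 𝟙 (zero ≟ d)
    vertical zero = line-refl zero (a , b)
    vertical (suc s) = trans (cong [p∣_] (cancel (ι b′) (ι b) (ι s * ι a)))
                             (trans ([p∣ι-ι] b′ b) (𝟙-false (b ≟ b′) (x≢y ∘ cong (a ,_))))
  ... | no a≢a′ = suc s₀ , oblique
    where
    s₀ : Fin p
    s₀ = proj₁ (linear-root (a≢a′ ∘ ι-injective) (ι b - ι b′))
    root : ∀ s → [p∣ (ι a - ι a′) * ι s - (ι b - ι b′) ] ≡ 𝟙 (s₀ ≟ s)
    root = proj₂ (linear-root (a≢a′ ∘ ι-injective) (ι b - ι b′))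
    rearrange : ∀ a a′ b b′ s → (b′ - s * a′) - (b - s * a) ≡ (a - a′) * s - (b - b′)
    rearrange = solve-∀
    oblique : ∀ d → line d (a , b) (a′ , b′) ≡ 𝟙 (suc s₀ ≟ d)
    oblique zero = trans ([p∣ι-ι] a′ a) (𝟙-false (a ≟ a′) a≢a′)
    oblique (suc s) = trans (cong [p∣_] (rearrange (ι a) (ι a′) (ι b) (ι b′) (ι s))) (root s)

  lines-through : ∀ x y → sum (λ d → line d x y) ≡ 1ℤ + + p * 𝟙 (x ≟₂ y)
  lines-through x y with x ≟₂ y
  ... | yes refl = begin
    sum (λ d → line d x x)  ≡⟨ sum-cong-≗ (λ d → line-refl d x) ⟩
    sum {suc p} (λ _ → 1ℤ)  ≡⟨ sum-const (suc p) 1ℤ ⟩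
    + suc p * 1ℤ            ≡⟨ ℤₚ.*-identityʳ (+ suc p) ⟩
    1ℤ + + p                ≡⟨ cong (_+_ 1ℤ) (ℤₚ.*-identityʳ (+ p)) ⟨
    1ℤ + + p * 1ℤ           ∎
    where open ≡-Reasoning
  ... | no x≢y = trans (sum-cong-≗ (proj₂ (line-through-distinct x≢y)))
                        (trans (sum-𝟙≟ (proj₁ (line-through-distinct x≢y))) (cong (_+_ 1ℤ) (sym (ℤₚ.*-zeroʳ (+ p)))))

  vertical-line-sum : ∀ x (g : Fin p → ℤ) → ∑ₚ (λ y → line zero x y * g (proj₁ y)) ≡ + p * g (proj₁ x)
  vertical-line-sum x@(a₀ , _) g = begin
    ∑ₚ (λ y → line zero x y * g (proj₁ y))
      ≡⟨ ∑ₚ-as-double-sum (λ y → line zero x y * g (proj₁ y)) ⟩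
    sum (λ a → sum {p} (λ _ → [p∣ ι a - ι a₀ ] * g a))
      ≡⟨ sum-cong-≗ (λ a → sum-const p ([p∣ ι a - ι a₀ ] * g a)) ⟩
    sum (λ a → + p * ([p∣ ι a - ι a₀ ] * g a))
      ≡⟨ *-distribˡ-sum (+ p) (λ a → [p∣ ι a - ι a₀ ] * g a) ⟨
    + p * sum (λ a → [p∣ ι a - ι a₀ ] * g a)
      ≡⟨ cong (+ p *_) (sum-cong-≗ λ a → cong (_* g a) ([p∣ι-ι] a a₀)) ⟩
    + p * sum (λ a → 𝟙 (a₀ ≟ a) * g a)
      ≡⟨ cong (+ p *_) (sum-𝟙≟* a₀ g) ⟩
    + p * g a₀ ∎
    where open ≡-Reasoning

  oblique-line-sum : ∀ s x (g : Fin p → ℤ) → ∑ₚ (λ y → line (suc s) x y * g (proj₁ y)) ≡ sum g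
  oblique-line-sum s x g = begin
    ∑ₚ (λ y → line (suc s) x y * g (proj₁ y))
      ≡⟨ ∑ₚ-as-double-sum (λ y → line (suc s) x y * g (proj₁ y)) ⟩
    sum (λ a → sum (λ b → [p∣ ι b - ι s * ι a - φ (suc s) x ] * g a))
      ≡⟨ sum-cong-≗ (λ a → *-distribʳ-sum (g a) (λ b → [p∣ ι b - ι s * ι a - φ (suc s) x ])) ⟨
    sum (λ a → sum (λ b → [p∣ ι b - ι s * ι a - φ (suc s) x ]) * g a)
      ≡⟨ sum-cong-≗ (λ a → trans (cong (_* g a) (one-per-vertical s a (φ (suc s) x))) (ℤₚ.*-identityˡ (g a))) ⟩
    sum g ∎
    where open ≡-Reasoning

module Signs where
  open import Data.Integer.Base using (_+_; _*_; -_)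
  open import Data.Fin.Properties using (_≟_)
  open IntegerSums
  open Indicators

  IsUnit : ℤ → Set
  IsUnit x = x ≡ 1ℤ ⊎ x ≡ -1ℤ

  IsUnit-* : ∀ {x y} → IsUnit x → IsUnit y → IsUnit (x * y)
  IsUnit-* (inj₁ refl) (inj₁ refl) = inj₁ refl
  IsUnit-* (inj₁ refl) (inj₂ refl) = inj₂ refl
  IsUnit-* (inj₂ refl) (inj₁ refl) = inj₂ refl
  IsUnit-* (inj₂ refl) (inj₂ refl) = inj₁ refl

  IsUnit⇒square≡1 : ∀ {x} → IsUnit x → x * x ≡ 1ℤ
  IsUnit⇒square≡1 (inj₁ refl) = refl
  IsUnit⇒square≡1 (inj₂ refl) = refl

  ε : ∀ {n} → Fin n → ℤ
  ε zero = 1ℤ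
  ε (suc k) = - ε k

  ε-unit : ∀ {n} (k : Fin n) → IsUnit (ε k)
  ε-unit zero = inj₁ refl
  ε-unit (suc k) with ε-unit k
  ... | inj₁ εk≡1 = inj₂ (cong -_ εk≡1)
  ... | inj₂ εk≡-1 = inj₁ (cong -_ εk≡-1)

  sum-ε-odd : ∀ k → sum {suc (k ℕ.+ k)} ε ≡ 1ℤ
  sum-ε-odd zero = refl
  sum-ε-odd (suc k) = begin
    sum {suc (suc k ℕ.+ suc k)} ε
      ≡⟨ cong (λ n → sum {suc (suc n)} ε) (ℕₚ.+-suc k k) ⟩
    1ℤ + (-1ℤ + sum {suc (k ℕ.+ k)} (λ j → - - ε j))
      ≡⟨ cong (λ x → 1ℤ + (-1ℤ + x)) (sum-cong-≗ {suc (k ℕ.+ k)} (λ j → ℤₚ.neg-involutive (ε j))) ⟩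
    1ℤ + (-1ℤ + sum {suc (k ℕ.+ k)} ε)
      ≡⟨ cong (λ x → 1ℤ + (-1ℤ + x)) (sum-ε-odd k) ⟩
    1ℤ ∎
    where open ≡-Reasoning

  sum-ε-even : ∀ k → sum {suc (suc (k ℕ.+ k))} ε ≡ 0ℤ
  sum-ε-even k = cong (_+_ 1ℤ) (trans (sum-neg {suc (k ℕ.+ k)} ε) (cong -_ (sum-ε-odd k)))

  balanced-signs-gram : ∀ {n} (σ : Fin n → ℤ) → (∀ d → IsUnit (σ d)) → sum σ ≡ 0ℤ → ∀ (t : Fin n → ℤ) →
                        sum (λ d → sum (λ e → σ d * σ e * (1ℤ + 𝟙 (d ≟ e) * t d))) ≡ sum t
  balanced-signs-gram {n} σ σ-unit Σσ≡0 t = sum-cong-≗ row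
    where
    split : ∀ a b δ t → a * b * (1ℤ + δ * t) ≡ a * b + δ * (a * b * t)
    split = solve-∀
    row : ∀ d → sum (λ e → σ d * σ e * (1ℤ + 𝟙 (d ≟ e) * t d)) ≡ t d
    row d = begin
      sum (λ e → σ d * σ e * (1ℤ + 𝟙 (d ≟ e) * t d))
        ≡⟨ sum-cong-≗ (λ e → split (σ d) (σ e) (𝟙 (d ≟ e)) (t d)) ⟩
      sum (λ e → σ d * σ e + 𝟙 (d ≟ e) * (σ d * σ e * t d))
        ≡⟨ ∑-distrib-+ (λ e → σ d * σ e) (λ e → 𝟙 (d ≟ e) * (σ d * σ e * t d)) ⟩
      sum (λ e → σ d * σ e) + sum (λ e → 𝟙 (d ≟ e) * (σ d * σ e * t d))
        ≡⟨ cong₂ _+_ (trans (sym (*-distribˡ-sum (σ d) σ)) (cong (σ d *_) Σσ≡0))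
                     (sum-𝟙≟* d (λ e → σ d * σ e * t d)) ⟩
      σ d * 0ℤ + σ d * σ d * t d
        ≡⟨ cong₂ _+_ (ℤₚ.*-zeroʳ (σ d)) (cong (_* t d) (IsUnit⇒square≡1 (σ-unit d))) ⟩
      0ℤ + 1ℤ * t d
        ≡⟨ trans (ℤₚ.+-identityˡ (1ℤ * t d)) (ℤₚ.*-identityˡ (t d)) ⟩
      t d ∎
      where open ≡-Reasoning

module ConferenceMatrices where
  open import Data.Integer.Base using (_+_; _*_; _-_)
  open import Data.Fin.Properties using (_≟_)
  open IntegerSums
  open Indicators
  open Signs

  Matrix : ℕ → Set
  Matrix n = Fin n → Fin n → ℤ

  record IsSeidelMatrix {n} (S : Matrix n) : Set where
    field
      symmetric         : ∀ j k → S j k ≡ S k j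
      zero-diagonal     : ∀ j → S j j ≡ 0ℤ
      unit-off-diagonal : ∀ j k → j ≢ k → IsUnit (S j k)

  record IsConferenceCore {n} (S : Matrix n) : Set where
    field
      isSeidelMatrix : IsSeidelMatrix S
      row-sum        : ∀ j → sum (S j) ≡ 0ℤ
      gram           : ∀ j k → sum (λ l → S j l * S k l) ≡ + n * 𝟙 (j ≟ k) - 1ℤ

  record IsSymmetricConferenceMatrix {n} (C : Matrix (suc n)) : Set where
    field
      isSeidelMatrix : IsSeidelMatrix C
      gram           : ∀ j k → sum (λ l → C j l * C k l) ≡ + n * 𝟙 (j ≟ k)

  module Bordering {n} {S : Matrix n} (core : IsConferenceCore S)
                   {e : Fin n → ℤ} (e-unit : ∀ j → IsUnit (e j))
                   {r : ℤ} (e-sum : sum e ≡ r) (S-e : ∀ j → sum (λ l → S j l * e l) ≡ r * e j - 1ℤ) where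
    open IsConferenceCore core
    open IsSeidelMatrix isSeidelMatrix

    -- diag(1, e) · [[0, 1ᵀ], [1, S]] · diag(1, e)
    bordered : Matrix (suc n)
    bordered zero zero = 0ℤ
    bordered zero (suc k) = e k
    bordered (suc j) zero = e j
    bordered (suc j) (suc k) = e j * e k * S j k

    private
      e²≡1 : ∀ l → e l * e l ≡ 1ℤ
      e²≡1 l = IsUnit⇒square≡1 (e-unit l)

      absorb : ∀ j k → e j * e k * 𝟙 (j ≟ k) ≡ 𝟙 (j ≟ k)
      absorb j k with j ≟ k
      ... | yes refl = trans (ℤₚ.*-identityʳ (e j * e j)) (e²≡1 j)
      ... | no _ = ℤₚ.*-zeroʳ (e j * e k)

      border-row : ∀ k → sum (λ l → e l * (e k * e l * S k l)) ≡ 0ℤ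
      border-row k = begin
        sum (λ l → e l * (e k * e l * S k l))
          ≡⟨ sum-cong-≗ (λ l → trans (regroup (e l) (e k) (S k l)) (cong (λ x → e k * (S k l * x)) (e²≡1 l))) ⟩
        sum (λ l → e k * (S k l * 1ℤ))
          ≡⟨ *-distribˡ-sum (e k) (λ l → S k l * 1ℤ) ⟨
        e k * sum (λ l → S k l * 1ℤ)
          ≡⟨ cong (e k *_) (trans (sum-cong-≗ λ l → ℤₚ.*-identityʳ (S k l)) (row-sum k)) ⟩
        e k * 0ℤ
          ≡⟨ ℤₚ.*-zeroʳ (e k) ⟩
        0ℤ ∎
        where
        open ≡-Reasoning
        regroup : ∀ a b s → a * (b * a * s) ≡ b * (s * (a * a))
        regroup = solve-∀

      inner-gram : ∀ j k → sum (λ l → e j * e l * S j l * (e k * e l * S k l)) ≡ e j * e k * (+ n * 𝟙 (j ≟ k) - 1ℤ)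
      inner-gram j k = begin
        sum (λ l → e j * e l * S j l * (e k * e l * S k l))
          ≡⟨ sum-cong-≗ (λ l → trans (regroup (e j) (e k) (e l) (S j l) (S k l))
                                     (cong (λ x → e j * e k * (S j l * S k l * x)) (e²≡1 l))) ⟩
        sum (λ l → e j * e k * (S j l * S k l * 1ℤ))
          ≡⟨ *-distribˡ-sum (e j * e k) (λ l → S j l * S k l * 1ℤ) ⟨
        e j * e k * sum (λ l → S j l * S k l * 1ℤ)
          ≡⟨ cong (e j * e k *_) (trans (sum-cong-≗ λ l → ℤₚ.*-identityʳ (S j l * S k l)) (gram j k)) ⟩
        e j * e k * (+ n * 𝟙 (j ≟ k) - 1ℤ) ∎
        where
        open ≡-Reasoning
        regroup : ∀ a b c s t → a * c * s * (b * c * t) ≡ a * b * (s * t * (c * c))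
        regroup = solve-∀

    bordered-gram : ∀ j k → sum (λ l → bordered j l * bordered k l) ≡ + n * 𝟙 (j ≟ k)
    bordered-gram zero zero = begin
      0ℤ + sum (λ l → e l * e l) ≡⟨ ℤₚ.+-identityˡ _ ⟩
      sum (λ l → e l * e l)      ≡⟨ sum-cong-≗ e²≡1 ⟩
      sum {n} (λ _ → 1ℤ)         ≡⟨ sum-const n 1ℤ ⟩
      + n * 1ℤ                   ∎
      where open ≡-Reasoning
    bordered-gram zero (suc k) = trans (ℤₚ.+-identityˡ _) (trans (border-row k) (sym (ℤₚ.*-zeroʳ (+ n))))
    bordered-gram (suc j) zero = begin
      e j * 0ℤ + sum (λ l → e j * e l * S j l * e l)
        ≡⟨ cong₂ _+_ (ℤₚ.*-zeroʳ (e j)) (sum-cong-≗ λ l → ℤₚ.*-comm (e j * e l * S j l) (e l)) ⟩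
      0ℤ + sum (λ l → e l * (e j * e l * S j l))
        ≡⟨ ℤₚ.+-identityˡ _ ⟩
      sum (λ l → e l * (e j * e l * S j l))
        ≡⟨ border-row j ⟩
      0ℤ
        ≡⟨ ℤₚ.*-zeroʳ (+ n) ⟨
      + n * 0ℤ ∎
      where open ≡-Reasoning
    bordered-gram (suc j) (suc k) = begin
      e j * e k + sum (λ l → e j * e l * S j l * (e k * e l * S k l)) ≡⟨ cong (_+_ (e j * e k)) (inner-gram j k) ⟩
      e j * e k + e j * e k * (+ n * 𝟙 (j ≟ k) - 1ℤ)                 ≡⟨ collect (e j * e k) (+ n) (𝟙 (j ≟ k)) ⟩
      + n * (e j * e k * 𝟙 (j ≟ k))                                  ≡⟨ cong (+ n *_) (absorb j k) ⟩
      + n * 𝟙 (j ≟ k)                                                ∎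
      where
      open ≡-Reasoning
      collect : ∀ x n δ → x + x * (n * δ - 1ℤ) ≡ n * (x * δ)
      collect = solve-∀

    bordered-row-sum : ∀ j → sum (bordered j) ≡ r
    bordered-row-sum zero = trans (ℤₚ.+-identityˡ _) e-sum
    bordered-row-sum (suc j) = begin
      e j + sum (λ l → e j * e l * S j l)   ≡⟨ cong (_+_ (e j)) (sum-cong-≗ λ l → regroup (e j) (e l) (S j l)) ⟩
      e j + sum (λ l → e j * (S j l * e l)) ≡⟨ cong (_+_ (e j)) (*-distribˡ-sum (e j) (λ l → S j l * e l)) ⟨
      e j + e j * sum (λ l → S j l * e l)   ≡⟨ cong (λ x → e j + e j * x) (S-e j) ⟩
      e j + e j * (r * e j - 1ℤ)           ≡⟨ collect (e j) r ⟩
      r * (e j * e j)                      ≡⟨ cong (r *_) (e²≡1 j) ⟩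
      r * 1ℤ                               ≡⟨ ℤₚ.*-identityʳ r ⟩
      r                                    ∎
      where
      open ≡-Reasoning
      regroup : ∀ a b s → a * b * s ≡ a * (s * b)
      regroup = solve-∀
      collect : ∀ x r → x + x * (r * x - 1ℤ) ≡ r * (x * x)
      collect = solve-∀

    bordered-isSeidelMatrix : IsSeidelMatrix bordered
    bordered-isSeidelMatrix = record
      { symmetric = bordered-symmetric
      ; zero-diagonal = bordered-zero-diagonal
      ; unit-off-diagonal = bordered-unit
      }
      where
      bordered-symmetric : ∀ j k → bordered j k ≡ bordered k j
      bordered-symmetric zero zero = refl
      bordered-symmetric zero (suc k) = refl
      bordered-symmetric (suc j) zero = refl
      bordered-symmetric (suc j) (suc k) = cong₂ _*_ (ℤₚ.*-comm (e j) (e k)) (symmetric j k)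
      bordered-zero-diagonal : ∀ j → bordered j j ≡ 0ℤ
      bordered-zero-diagonal zero = refl
      bordered-zero-diagonal (suc j) = trans (cong (e j * e j *_) (zero-diagonal j)) (ℤₚ.*-zeroʳ (e j * e j))
      bordered-unit : ∀ j k → j ≢ k → IsUnit (bordered j k)
      bordered-unit zero zero 0≢0 = contradiction refl 0≢0
      bordered-unit zero (suc k) _ = e-unit k
      bordered-unit (suc j) zero _ = e-unit j
      bordered-unit (suc j) (suc k) j≢k = IsUnit-* (IsUnit-* (e-unit j) (e-unit k)) (unit-off-diagonal j k (j≢k ∘ cong suc))

    bordered-isSymmetricConferenceMatrix : IsSymmetricConferenceMatrix bordered
    bordered-isSymmetricConferenceMatrix = record
      { isSeidelMatrix = bordered-isSeidelMatrix
      ; gram = bordered-gram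
      }

module OddPlaneConference (p : ℕ) (p-prime : Prime p) (h : ℕ) (p≡1+2h : p ≡ suc (h ℕ.+ h)) where
  open import Data.Integer.Base using (_+_; _*_; -_; _-_)
  open import Data.Fin.Properties using (_≟_)
  open IntegerSums
  open Indicators
  open Signs
  open ConferenceMatrices

  open AffinePlane p p-prime

  sum-ε-points : sum {p} ε ≡ 1ℤ
  sum-ε-points = subst (λ n → sum {n} ε ≡ 1ℤ) (sym p≡1+2h) (sum-ε-odd h)

  sum-ε-directions : sum {suc p} ε ≡ 0ℤ
  sum-ε-directions = subst (λ n → sum {suc n} ε ≡ 0ℤ) (sym p≡1+2h) (sum-ε-even h)

  core : Point → Point → ℤ
  core x y = sum (λ d → ε d * line d x y)

  σ : Point → ℤ
  σ = ε ∘ proj₁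

  core-symmetric : ∀ x y → core x y ≡ core y x
  core-symmetric x y = sum-cong-≗ λ d → cong (ε d *_) (line-sym d x y)

  core-zero-diagonal : ∀ x → core x x ≡ 0ℤ
  core-zero-diagonal x = trans (sum-cong-≗ λ d → trans (cong (ε d *_) (line-refl d x)) (ℤₚ.*-identityʳ (ε d))) sum-ε-directions

  core-unit-off-diagonal : ∀ {x y} → x ≢ y → IsUnit (core x y)
  core-unit-off-diagonal {x} {y} x≢y = subst IsUnit (sym core≡ε) (ε-unit d₀)
    where
    d₀ : Direction
    d₀ = proj₁ (line-through-distinct x≢y)
    core≡ε : core x y ≡ ε d₀
    core≡ε = trans
      (sum-cong-≗ λ d → trans (cong (ε d *_) (proj₂ (line-through-distinct x≢y) d)) (ℤₚ.*-comm (ε d) (𝟙 (d₀ ≟ d))))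
      (sum-𝟙≟* d₀ ε)

  core-row-sum : ∀ x → ∑ₚ (core x) ≡ 0ℤ
  core-row-sum x = begin
    ∑ₚ (λ y → sum (λ d → ε d * line d x y))  ≡⟨ ∑ₚ-sum-comm (λ d y → ε d * line d x y) ⟩
    sum (λ d → ∑ₚ (λ y → ε d * line d x y))  ≡⟨ sum-cong-≗ (λ d → ∑ₚ-*ˡ (ε d) (line d x)) ⟩
    sum (λ d → ε d * ∑ₚ (line d x))          ≡⟨ sum-cong-≗ (λ d → cong (ε d *_) (level-size d (φ d x))) ⟩
    sum {suc p} (λ d → ε d * + p)            ≡⟨ *-distribʳ-sum (+ p) (ε {suc p}) ⟨
    sum {suc p} ε * + p                      ≡⟨ cong (_* + p) sum-ε-directions ⟩
    0ℤ                                       ∎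
    where open ≡-Reasoning

  private
    product-expansion : ∀ x x′ y → core x y * core x′ y ≡ sum (λ d → sum (λ e → ε d * ε e * (line d x y * line e x′ y)))
    product-expansion x x′ y = trans (sum-*-sum (λ d → ε d * line d x y) (λ e → ε e * line e x′ y))
      (sum-cong-≗ λ d → sum-cong-≗ λ e → regroup (ε d) (ε e) (line d x y) (line e x′ y))
      where
      regroup : ∀ a b s t → a * s * (b * t) ≡ a * b * (s * t)
      regroup = solve-∀

  core-gram : ∀ x x′ → ∑ₚ (λ y → core x y * core x′ y) ≡ + p * + p * 𝟙 (x ≟₂ x′) - 1ℤ
  core-gram x x′ = begin
    ∑ₚ (λ y → core x y * core x′ y)
      ≡⟨ sum-cong-≗ (λ k → product-expansion x x′ (remQuot p k)) ⟩
    ∑ₚ (λ y → sum (λ d → sum (λ e → ε d * ε e * (line d x y * line e x′ y))))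
      ≡⟨ ∑ₚ-sum-comm (λ d y → sum (λ e → ε d * ε e * (line d x y * line e x′ y))) ⟩
    sum (λ d → ∑ₚ (λ y → sum (λ e → ε d * ε e * (line d x y * line e x′ y))))
      ≡⟨ sum-cong-≗ (λ d → ∑ₚ-sum-comm (λ e y → ε d * ε e * (line d x y * line e x′ y))) ⟩
    sum (λ d → sum (λ e → ∑ₚ (λ y → ε d * ε e * (line d x y * line e x′ y))))
      ≡⟨ sum-cong-≗ (λ d → sum-cong-≗ λ e → trans (∑ₚ-*ˡ (ε d * ε e) (λ y → line d x y * line e x′ y))
                                                  (cong (ε d * ε e *_) (line-intersection d e x x′))) ⟩
    sum (λ d → sum (λ e → ε d * ε e * (1ℤ + 𝟙 (d ≟ e) * (+ p * line d x x′ - 1ℤ))))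
      ≡⟨ balanced-signs-gram ε ε-unit sum-ε-directions (λ d → + p * line d x x′ - 1ℤ) ⟩
    sum (λ d → + p * line d x x′ + -1ℤ)
      ≡⟨ ∑-distrib-+ (λ d → + p * line d x x′) (λ _ → -1ℤ) ⟩
    sum (λ d → + p * line d x x′) + sum {suc p} (λ _ → -1ℤ)
      ≡⟨ cong₂ _+_ (sym (*-distribˡ-sum (+ p) (λ d → line d x x′))) (sum-const (suc p) -1ℤ) ⟩
    + p * sum (λ d → line d x x′) + + suc p * -1ℤ
      ≡⟨ cong (λ t → + p * t + + suc p * -1ℤ) (lines-through x x′) ⟩
    + p * (1ℤ + + p * 𝟙 (x ≟₂ x′)) + (1ℤ + + p) * -1ℤ
      ≡⟨ collect (+ p) (𝟙 (x ≟₂ x′)) ⟩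
    + p * + p * 𝟙 (x ≟₂ x′) - 1ℤ ∎
    where
    open ≡-Reasoning
    collect : ∀ q δ → q * (1ℤ + q * δ) + (1ℤ + q) * -1ℤ ≡ q * q * δ - 1ℤ
    collect = solve-∀

  core-σ : ∀ x → ∑ₚ (λ y → core x y * σ y) ≡ + p * σ x - 1ℤ
  core-σ x = begin
    ∑ₚ (λ y → core x y * σ y)
      ≡⟨ sum-cong-≗ (λ k → distribute (remQuot p k)) ⟩
    ∑ₚ (λ y → sum (λ d → ε d * (line d x y * σ y)))
      ≡⟨ ∑ₚ-sum-comm (λ d y → ε d * (line d x y * σ y)) ⟩
    sum (λ d → ∑ₚ (λ y → ε d * (line d x y * σ y)))
      ≡⟨ sum-cong-≗ (λ d → ∑ₚ-*ˡ (ε d) (λ y → line d x y * σ y)) ⟩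
    sum (λ d → ε d * ∑ₚ (λ y → line d x y * σ y))
      ≡⟨ cong₂ _+_ (cong (1ℤ *_) (vertical-line-sum x ε)) (sum-cong-≗ λ s → cong (- ε s *_) (oblique-line-sum s x ε)) ⟩
    1ℤ * (+ p * σ x) + sum {p} (λ s → - ε s * sum {p} ε)
      ≡⟨ cong₂ _+_ (ℤₚ.*-identityˡ (+ p * σ x))
                   (sum-cong-≗ {p} λ s → trans (cong (- ε s *_) sum-ε-points) (ℤₚ.*-identityʳ (- ε s))) ⟩
    + p * σ x + sum {p} (λ s → - ε s)
      ≡⟨ cong (_+_ (+ p * σ x)) (trans (sum-neg {p} ε) (cong -_ sum-ε-points)) ⟩
    + p * σ x - 1ℤ ∎
    where
    open ≡-Reasoning
    distribute : ∀ y → core x y * σ y ≡ sum (λ d → ε d * (line d x y * σ y))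
    distribute y = trans (*-distribʳ-sum (σ y) (λ d → ε d * line d x y)) (sum-cong-≗ λ d → ℤₚ.*-assoc (ε d) (line d x y) (σ y))

  σ-sum : ∑ₚ σ ≡ + p
  σ-sum = begin
    ∑ₚ σ                               ≡⟨ ∑ₚ-as-double-sum σ ⟩
    sum {p} (λ a → sum {p} (λ _ → ε a)) ≡⟨ sum-cong-≗ {p} (λ a → sum-const p (ε a)) ⟩
    sum {p} (λ a → + p * ε a)          ≡⟨ *-distribˡ-sum (+ p) (ε {p}) ⟨
    + p * sum {p} ε                    ≡⟨ cong (+ p *_) sum-ε-points ⟩
    + p * 1ℤ                           ≡⟨ ℤₚ.*-identityʳ (+ p) ⟩
    + p                                ∎
    where open ≡-Reasoning

  S : Matrix (p ℕ.* p)
  S j k = core (remQuot p j) (remQuot p k)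

  S-isConferenceCore : IsConferenceCore S
  S-isConferenceCore = record
    { isSeidelMatrix = record
      { symmetric = λ j k → core-symmetric (remQuot p j) (remQuot p k)
      ; zero-diagonal = λ j → core-zero-diagonal (remQuot p j)
      ; unit-off-diagonal = λ j k j≢k → core-unit-off-diagonal (j≢k ∘ remQuot-injective {p} p)
      }
    ; row-sum = λ j → core-row-sum (remQuot p j)
    ; gram = λ j k → trans (core-gram (remQuot p j) (remQuot p k))
                           (cong₂ (λ q t → q * t - 1ℤ) (sym (ℤₚ.pos-* p p)) (𝟙-≟-remQuot {p} p j k))
    }

  open Bordering S-isConferenceCore {e = σ ∘ remQuot {p} p} (λ j → ε-unit (proj₁ (remQuot {p} p j)))
                 σ-sum (λ j → core-σ (remQuot p j))
    public using (bordered; bordered-isSymmetricConferenceMatrix; bordered-row-sum)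

module Doubling {n : ℕ} {C : ConferenceMatrices.Matrix (suc n)}
                (C-conference : ConferenceMatrices.IsSymmetricConferenceMatrix C)
                {r : ℤ} (C-row-sum : ∀ j → sum (C j) ≡ r) where
  open import Data.Integer.Base using (_+_; _*_; -_; _-_)
  open import Data.Fin.Properties using (_≟_)
  open import Data.Fin.Patterns using (0F; 1F)
  open Indicators
  open ConferenceMatrices
  open GaussianIntegers
  open IsSymmetricConferenceMatrix C-conference
  open IsSeidelMatrix isSeidelMatrix
  open ℤ[i]-Solver using (solve; _⊜_) renaming (_⊕_ to _:+_; _⊗_ to _:*_; ⊝_ to :-_; Κ to con)

  m : ℕ
  m = suc n

  -- doubled = X ⊗ I + Y ⊗ C is Hadamard as X X* = Y Y* = 2 I and X Y* + Y X* = 0, and of skew type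
  -- as X − I and Y are skew-Hermitian.
  X Y : Fin 2 → Fin 2 → Quat
  X 0F 0F = q1
  X 0F 1F = qi
  X 1F 0F = qi
  X 1F 1F = q1
  Y 0F 0F = qi
  Y 0F 1F = qm1
  Y 1F 0F = q1
  Y 1F 1F = qmi

  𝕏 𝕐 : Fin 2 → Fin 2 → ℤ[i]
  𝕏 u v = ⟦ X u v ⟧
  𝕐 u v = ⟦ Y u v ⟧

  XX*≡2I : ∀ u u′ → sumᵢ (λ w → 𝕏 u w ⊗ conj (𝕏 u′ w)) ≡ fromℤ (+ 2 * 𝟙 (u ≟ u′))
  XX*≡2I 0F 0F = refl
  XX*≡2I 0F 1F = refl
  XX*≡2I 1F 0F = refl
  XX*≡2I 1F 1F = refl

  YY*≡2I : ∀ u u′ → sumᵢ (λ w → 𝕐 u w ⊗ conj (𝕐 u′ w)) ≡ fromℤ (+ 2 * 𝟙 (u ≟ u′))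
  YY*≡2I 0F 0F = refl
  YY*≡2I 0F 1F = refl
  YY*≡2I 1F 0F = refl
  YY*≡2I 1F 1F = refl

  XY*+YX*≡0 : ∀ u u′ → sumᵢ (λ w → 𝕏 u w ⊗ conj (𝕐 u′ w) ⊕ 𝕐 u w ⊗ conj (𝕏 u′ w)) ≡ 0ᵢ
  XY*+YX*≡0 0F 0F = refl
  XY*+YX*≡0 0F 1F = refl
  XY*+YX*≡0 1F 0F = refl
  XY*+YX*≡0 1F 1F = refl

  X-skew : ∀ u v → conj (𝕏 v u ⊖ fromℤ (𝟙 (v ≟ u))) ≡ ⊝ (𝕏 u v ⊖ fromℤ (𝟙 (u ≟ v)))
  X-skew 0F 0F = refl
  X-skew 0F 1F = refl
  X-skew 1F 0F = refl
  X-skew 1F 1F = refl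

  Y-skew : ∀ u v → conj (𝕐 v u) ≡ ⊝ 𝕐 u v
  Y-skew 0F 0F = refl
  Y-skew 0F 1F = refl
  Y-skew 1F 0F = refl
  Y-skew 1F 1F = refl

  neg : Quat → Quat
  neg q1 = qm1
  neg qm1 = q1
  neg qi = qmi
  neg qmi = qi

  ⟦neg⟧ : ∀ x → ⟦ neg x ⟧ ≡ ⊝ ⟦ x ⟧
  ⟦neg⟧ q1 = refl
  ⟦neg⟧ qm1 = refl
  ⟦neg⟧ qi = refl
  ⟦neg⟧ qmi = refl

  entry : Quat → Quat → Fin m → Fin m → Quat
  entry x y j l = if does (j ≟ l) then x else if does (C j l ℤₚ.≟ 1ℤ) then y else neg y

  δ′ C′ : Fin m → Fin m → ℤ[i]
  δ′ j l = fromℤ (𝟙 (j ≟ l))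
  C′ j l = fromℤ (C j l)

  ⟦entry⟧ : ∀ x y j l → ⟦ entry x y j l ⟧ ≡ ⟦ x ⟧ ⊗ δ′ j l ⊕ ⟦ y ⟧ ⊗ C′ j l
  ⟦entry⟧ x y j l = select (j ≟ l) (C j l ℤₚ.≟ 1ℤ)
    where
    on-diagonal : ∀ a b → a ≡ a ⊗ 1ᵢ ⊕ b ⊗ 0ᵢ
    on-diagonal = solve 2 (λ a b → a ⊜ (a :* con 1ᵢ :+ b :* con 0ᵢ)) refl
    off-diagonal : ∀ a b → b ≡ a ⊗ 0ᵢ ⊕ b ⊗ 1ᵢ
    off-diagonal = solve 2 (λ a b → b ⊜ (a :* con 0ᵢ :+ b :* con 1ᵢ)) refl
    negated : ∀ a b → ⊝ b ≡ a ⊗ 0ᵢ ⊕ b ⊗ fromℤ -1ℤ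
    negated = solve 2 (λ a b → (:- b) ⊜ (a :* con 0ᵢ :+ b :* con (fromℤ -1ℤ))) refl
    select : ∀ {j l} (j≟l : Dec (j ≡ l)) (c≟1 : Dec (C j l ≡ 1ℤ)) →
             ⟦ if does j≟l then x else if does c≟1 then y else neg y ⟧ ≡ ⟦ x ⟧ ⊗ fromℤ (𝟙 j≟l) ⊕ ⟦ y ⟧ ⊗ C′ j l
    select {j} (yes refl) _ =
      trans (on-diagonal ⟦ x ⟧ ⟦ y ⟧) (cong (λ c → ⟦ x ⟧ ⊗ 1ᵢ ⊕ ⟦ y ⟧ ⊗ fromℤ c) (sym (zero-diagonal j)))
    select (no _) (yes c≡1) = trans (off-diagonal ⟦ x ⟧ ⟦ y ⟧) (cong (λ c → ⟦ x ⟧ ⊗ 0ᵢ ⊕ ⟦ y ⟧ ⊗ fromℤ c) (sym c≡1))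
    select {j} {l} (no j≢l) (no c≢1) with unit-off-diagonal j l j≢l
    ... | inj₁ c≡1 = contradiction c≡1 c≢1
    ... | inj₂ c≡-1 =
      trans (⟦neg⟧ y) (trans (negated ⟦ x ⟧ ⟦ y ⟧) (cong (λ c → ⟦ x ⟧ ⊗ 0ᵢ ⊕ ⟦ y ⟧ ⊗ fromℤ c) (sym c≡-1)))

  block : Fin 2 × Fin m → Fin 2 × Fin m → Quat
  block (u , j) (v , l) = entry (X u v) (Y u v) j l

  doubled : QMatrix (2 ℕ.* m)
  doubled k l = block (remQuot {2} m k) (remQuot {2} m l)

  ⟦block⟧ : ∀ u j v l → ⟦ block (u , j) (v , l) ⟧ ≡ 𝕏 u v ⊗ δ′ j l ⊕ 𝕐 u v ⊗ C′ j l
  ⟦block⟧ u j v l = ⟦entry⟧ (X u v) (Y u v) j l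

  n′ : ℤ[i]
  n′ = fromℤ (+ n)

  row-product : ∀ α β γ ζ j k →
    sumᵢ (λ l → (α ⊗ δ′ j l ⊕ β ⊗ C′ j l) ⊗ (γ ⊗ δ′ k l ⊕ ζ ⊗ C′ k l))
      ≡ (α ⊗ γ ⊕ n′ ⊗ (β ⊗ ζ)) ⊗ δ′ j k ⊕ (α ⊗ ζ ⊕ β ⊗ γ) ⊗ C′ j k
  row-product α β γ ζ j k = begin
    sumᵢ (λ l → (α ⊗ δ′ j l ⊕ β ⊗ C′ j l) ⊗ (γ ⊗ δ′ k l ⊕ ζ ⊗ C′ k l))
      ≡⟨ sumᵢ-bilinear α β γ ζ (λ l → 𝟙 (j ≟ l)) (C j) (λ l → 𝟙 (k ≟ l)) (C k) ⟩
    (α ⊗ γ ⊗ fromℤ (sum (λ l → 𝟙 (j ≟ l) * 𝟙 (k ≟ l))) ⊕ α ⊗ ζ ⊗ fromℤ (sum (λ l → 𝟙 (j ≟ l) * C k l)))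
      ⊕ (β ⊗ γ ⊗ fromℤ (sum (λ l → C j l * 𝟙 (k ≟ l))) ⊕ β ⊗ ζ ⊗ fromℤ (sum (λ l → C j l * C k l)))
      ≡⟨ cong₂ _⊕_ (cong₂ _⊕_ (cong (λ t → α ⊗ γ ⊗ fromℤ t) δδ) (cong (λ t → α ⊗ ζ ⊗ fromℤ t) δC))
                   (cong₂ _⊕_ (cong (λ t → β ⊗ γ ⊗ fromℤ t) Cδ)
                              (cong (β ⊗ ζ ⊗_) (trans (cong fromℤ (gram j k)) (fromℤ-* (+ n) (𝟙 (j ≟ k)))))) ⟩
    (α ⊗ γ ⊗ δ′ j k ⊕ α ⊗ ζ ⊗ C′ j k) ⊕ (β ⊗ γ ⊗ C′ j k ⊕ β ⊗ ζ ⊗ (n′ ⊗ δ′ j k))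
      ≡⟨ regroup α β γ ζ n′ (δ′ j k) (C′ j k) ⟩
    (α ⊗ γ ⊕ n′ ⊗ (β ⊗ ζ)) ⊗ δ′ j k ⊕ (α ⊗ ζ ⊕ β ⊗ γ) ⊗ C′ j k ∎
    where
    open ≡-Reasoning
    δδ : sum (λ l → 𝟙 (j ≟ l) * 𝟙 (k ≟ l)) ≡ 𝟙 (j ≟ k)
    δδ = trans (sum-𝟙≟* j (λ l → 𝟙 (k ≟ l))) (𝟙-≟-sym k j)
    δC : sum (λ l → 𝟙 (j ≟ l) * C k l) ≡ C j k
    δC = trans (sum-𝟙≟* j (C k)) (symmetric k j)
    Cδ : sum (λ l → C j l * 𝟙 (k ≟ l)) ≡ C j k
    Cδ = trans (sum-cong-≗ λ l → ℤₚ.*-comm (C j l) (𝟙 (k ≟ l))) (sum-𝟙≟* k (C j))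
    regroup : ∀ α β γ ζ ν d c → (α ⊗ γ ⊗ d ⊕ α ⊗ ζ ⊗ c) ⊕ (β ⊗ γ ⊗ c ⊕ β ⊗ ζ ⊗ (ν ⊗ d))
                                ≡ (α ⊗ γ ⊕ ν ⊗ (β ⊗ ζ)) ⊗ d ⊕ (α ⊗ ζ ⊕ β ⊗ γ) ⊗ c
    regroup = solve 7 (λ α β γ ζ ν d c → ((α :* γ :* d :+ α :* ζ :* c) :+ (β :* γ :* c :+ β :* ζ :* (ν :* d)))
                                       ⊜ ((α :* γ :+ ν :* (β :* ζ)) :* d :+ (α :* ζ :+ β :* γ) :* c)) refl

  private
    block-sum-linear : ∀ {b} (A B E : Fin b → ℤ[i]) d c →
      sumᵢ (λ w → (A w ⊕ n′ ⊗ B w) ⊗ d ⊕ E w ⊗ c) ≡ (sumᵢ A ⊕ n′ ⊗ sumᵢ B) ⊗ d ⊕ sumᵢ E ⊗ c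
    block-sum-linear A B E d c = begin
      sumᵢ (λ w → (A w ⊕ n′ ⊗ B w) ⊗ d ⊕ E w ⊗ c)
        ≡⟨ sumᵢ-distrib-+ (λ w → (A w ⊕ n′ ⊗ B w) ⊗ d) (λ w → E w ⊗ c) ⟩
      sumᵢ (λ w → (A w ⊕ n′ ⊗ B w) ⊗ d) ⊕ sumᵢ (λ w → E w ⊗ c)
        ≡⟨ cong₂ _⊕_ (⊗-distribʳ-sumᵢ d (λ w → A w ⊕ n′ ⊗ B w)) (⊗-distribʳ-sumᵢ c E) ⟨
      sumᵢ (λ w → A w ⊕ n′ ⊗ B w) ⊗ d ⊕ sumᵢ E ⊗ c
        ≡⟨ cong (λ z → z ⊗ d ⊕ sumᵢ E ⊗ c)
                (trans (sumᵢ-distrib-+ A (λ w → n′ ⊗ B w)) (cong (sumᵢ A ⊕_) (sym (⊗-distribˡ-sumᵢ n′ B)))) ⟩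
      (sumᵢ A ⊕ n′ ⊗ sumᵢ B) ⊗ d ⊕ sumᵢ E ⊗ c ∎
      where open ≡-Reasoning

    fromℤ-2m : fromℤ (+ (2 ℕ.* m)) ≡ fromℤ (+ 2) ⊗ (1ᵢ ⊕ n′)
    fromℤ-2m = trans (cong fromℤ (ℤₚ.pos-* 2 m)) (fromℤ-* (+ 2) (+ m))

  block-orthogonal : ∀ u j u′ j′ →
    sumᵢ (λ w → sumᵢ (λ l → ⟦ block (u , j) (w , l) ⟧ ⊗ conj ⟦ block (u′ , j′) (w , l) ⟧))
      ≡ fromℤ (+ (2 ℕ.* m)) ⊗ fromℤ (𝟙 (u ≟ u′) * 𝟙 (j ≟ j′))
  block-orthogonal u j u′ j′ = begin
    sumᵢ (λ w → sumᵢ (λ l → ⟦ block (u , j) (w , l) ⟧ ⊗ conj ⟦ block (u′ , j′) (w , l) ⟧))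
      ≡⟨ sumᵢ-cong-≗ (λ w → sumᵢ-cong-≗ λ l →
           cong₂ (λ a b → a ⊗ conj b) (⟦block⟧ u j w l) (⟦block⟧ u′ j′ w l)) ⟩
    sumᵢ (λ w → sumᵢ (λ l → (𝕏 u w ⊗ δ′ j l ⊕ 𝕐 u w ⊗ C′ j l)
                            ⊗ conj (𝕏 u′ w ⊗ δ′ j′ l ⊕ 𝕐 u′ w ⊗ C′ j′ l)))
      ≡⟨ sumᵢ-cong-≗ (λ w → sumᵢ-cong-≗ λ l → cong ((𝕏 u w ⊗ δ′ j l ⊕ 𝕐 u w ⊗ C′ j l) ⊗_)
                                                    (conj-real-combination (𝕏 u′ w) (𝕐 u′ w) (𝟙 (j′ ≟ l)) (C j′ l))) ⟩
    sumᵢ (λ w → sumᵢ (λ l → (𝕏 u w ⊗ δ′ j l ⊕ 𝕐 u w ⊗ C′ j l)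
                            ⊗ (conj (𝕏 u′ w) ⊗ δ′ j′ l ⊕ conj (𝕐 u′ w) ⊗ C′ j′ l)))
      ≡⟨ sumᵢ-cong-≗ (λ w → row-product (𝕏 u w) (𝕐 u w) (conj (𝕏 u′ w)) (conj (𝕐 u′ w)) j j′) ⟩
    sumᵢ (λ w → (𝕏 u w ⊗ conj (𝕏 u′ w) ⊕ n′ ⊗ (𝕐 u w ⊗ conj (𝕐 u′ w))) ⊗ δ′ j j′
                ⊕ (𝕏 u w ⊗ conj (𝕐 u′ w) ⊕ 𝕐 u w ⊗ conj (𝕏 u′ w)) ⊗ C′ j j′)
      ≡⟨ block-sum-linear (λ w → 𝕏 u w ⊗ conj (𝕏 u′ w)) (λ w → 𝕐 u w ⊗ conj (𝕐 u′ w))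
                       (λ w → 𝕏 u w ⊗ conj (𝕐 u′ w) ⊕ 𝕐 u w ⊗ conj (𝕏 u′ w)) (δ′ j j′) (C′ j j′) ⟩
    (sumᵢ (λ w → 𝕏 u w ⊗ conj (𝕏 u′ w)) ⊕ n′ ⊗ sumᵢ (λ w → 𝕐 u w ⊗ conj (𝕐 u′ w))) ⊗ δ′ j j′
      ⊕ sumᵢ (λ w → 𝕏 u w ⊗ conj (𝕐 u′ w) ⊕ 𝕐 u w ⊗ conj (𝕏 u′ w)) ⊗ C′ j j′
      ≡⟨ cong₂ (λ a b → a ⊗ δ′ j j′ ⊕ b ⊗ C′ j j′)
               (cong₂ (λ x y → x ⊕ n′ ⊗ y) (XX*≡2I u u′) (YY*≡2I u u′)) (XY*+YX*≡0 u u′) ⟩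
    (fromℤ (+ 2 * t) ⊕ n′ ⊗ fromℤ (+ 2 * t)) ⊗ δ′ j j′ ⊕ 0ᵢ ⊗ C′ j j′
      ≡⟨ trans (cong (λ x → (x ⊕ n′ ⊗ x) ⊗ δ′ j j′ ⊕ 0ᵢ ⊗ C′ j j′) (fromℤ-* (+ 2) t)) collect ⟩
    fromℤ (+ 2) ⊗ (1ᵢ ⊕ n′) ⊗ (fromℤ t ⊗ δ′ j j′)
      ≡⟨ cong₂ _⊗_ (sym fromℤ-2m) (sym (fromℤ-* t (𝟙 (j ≟ j′)))) ⟩
    fromℤ (+ (2 ℕ.* m)) ⊗ fromℤ (t * 𝟙 (j ≟ j′)) ∎
    where
    open ≡-Reasoning
    t : ℤ
    t = 𝟙 (u ≟ u′)
    collect : (fromℤ (+ 2) ⊗ fromℤ t ⊕ n′ ⊗ (fromℤ (+ 2) ⊗ fromℤ t)) ⊗ δ′ j j′ ⊕ 0ᵢ ⊗ C′ j j′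
              ≡ fromℤ (+ 2) ⊗ (1ᵢ ⊕ n′) ⊗ (fromℤ t ⊗ δ′ j j′)
    collect = ring (fromℤ (+ 2)) (fromℤ t) n′ (δ′ j j′) (C′ j j′)
      where
      ring : ∀ two τ ν d c → (two ⊗ τ ⊕ ν ⊗ (two ⊗ τ)) ⊗ d ⊕ 0ᵢ ⊗ c ≡ two ⊗ (1ᵢ ⊕ ν) ⊗ (τ ⊗ d)
      ring = solve 5 (λ two τ ν d c → ((two :* τ :+ ν :* (two :* τ)) :* d :+ con 0ᵢ :* c)
                                      ⊜ (two :* (con 1ᵢ :+ ν) :* (τ :* d))) refl

  block-of : Fin (2 ℕ.* m) → Fin 2
  block-of k = proj₁ (remQuot {2} m k)

  index-of : Fin (2 ℕ.* m) → Fin m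
  index-of k = proj₂ (remQuot {2} m k)

  δ-doubled : ∀ k k′ → δ k k′ ≡ fromℤ (𝟙 (block-of k ≟ block-of k′) * 𝟙 (index-of k ≟ index-of k′))
  δ-doubled k k′ = trans (δ≡fromℤ𝟙 k k′)
    (cong fromℤ (trans (sym (𝟙-≟-remQuot {2} m k k′)) (𝟙-≟₂ (block-of k) (block-of k′) (index-of k) (index-of k′))))

  doubled-isQuaternaryHadamard : IsQuaternaryHadamard (2 ℕ.* m) doubled
  doubled-isQuaternaryHadamard k k′ = begin
    ∑ (2 ℕ.* m) (λ l → ⟦ doubled k l ⟧ ⊗ conj ⟦ doubled k′ l ⟧)
      ≡⟨ ∑≡sumᵢ (2 ℕ.* m) (λ l → ⟦ doubled k l ⟧ ⊗ conj ⟦ doubled k′ l ⟧) ⟩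
    sumᵢ (λ l → F (remQuot {2} m l))
      ≡⟨ FiniteSums.sum-remQuot (CommutativeRing.semiring ℤ[i]-commutativeRing) 2 m F ⟩
    sumᵢ (λ w → sumᵢ (λ l → F (w , l)))
      ≡⟨ block-orthogonal (block-of k) (index-of k) (block-of k′) (index-of k′) ⟩
    fromℤ (+ (2 ℕ.* m)) ⊗ fromℤ (𝟙 (block-of k ≟ block-of k′) * 𝟙 (index-of k ≟ index-of k′))
      ≡⟨ cong (fromℤ (+ (2 ℕ.* m)) ⊗_) (δ-doubled k k′) ⟨
    fromℕ (2 ℕ.* m) ⊗ δ k k′ ∎
    where
    open ≡-Reasoning
    F : Fin 2 × Fin m → ℤ[i]
    F V = ⟦ block (remQuot {2} m k) V ⟧ ⊗ conj ⟦ block (remQuot {2} m k′) V ⟧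

  block-skew : ∀ u j v l →
    conj (⟦ block (v , l) (u , j) ⟧ ⊖ fromℤ (𝟙 (v ≟ u) * 𝟙 (l ≟ j)))
      ≡ ⊝ (⟦ block (u , j) (v , l) ⟧ ⊖ fromℤ (𝟙 (u ≟ v) * 𝟙 (j ≟ l)))
  block-skew u j v l = begin
    conj (⟦ block (v , l) (u , j) ⟧ ⊖ fromℤ (𝟙 (v ≟ u) * 𝟙 (l ≟ j)))
      ≡⟨ cong conj (shift-identity v l u j) ⟩
    conj ((𝕏 v u ⊖ fromℤ (𝟙 (v ≟ u))) ⊗ δ′ l j ⊕ 𝕐 v u ⊗ C′ l j)
      ≡⟨ conj-real-combination (𝕏 v u ⊖ fromℤ (𝟙 (v ≟ u))) (𝕐 v u) (𝟙 (l ≟ j)) (C l j) ⟩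
    conj (𝕏 v u ⊖ fromℤ (𝟙 (v ≟ u))) ⊗ δ′ l j ⊕ conj (𝕐 v u) ⊗ C′ l j
      ≡⟨ cong₂ _⊕_ (cong₂ _⊗_ (X-skew u v) (cong fromℤ (𝟙-≟-sym l j)))
                   (cong₂ _⊗_ (Y-skew u v) (cong fromℤ (symmetric l j))) ⟩
    ⊝ (𝕏 u v ⊖ fromℤ (𝟙 (u ≟ v))) ⊗ δ′ j l ⊕ ⊝ 𝕐 u v ⊗ C′ j l
      ≡⟨ negate (𝕏 u v ⊖ fromℤ (𝟙 (u ≟ v))) (𝕐 u v) (δ′ j l) (C′ j l) ⟩
    ⊝ ((𝕏 u v ⊖ fromℤ (𝟙 (u ≟ v))) ⊗ δ′ j l ⊕ 𝕐 u v ⊗ C′ j l)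
      ≡⟨ cong ⊝_ (shift-identity u j v l) ⟨
    ⊝ (⟦ block (u , j) (v , l) ⟧ ⊖ fromℤ (𝟙 (u ≟ v) * 𝟙 (j ≟ l))) ∎
    where
    open ≡-Reasoning
    negate : ∀ a b d c → ⊝ a ⊗ d ⊕ ⊝ b ⊗ c ≡ ⊝ (a ⊗ d ⊕ b ⊗ c)
    negate = solve 4 (λ a b d c → (:- a :* d :+ :- b :* c) ⊜ (:- (a :* d :+ b :* c))) refl
    shift : ∀ x y τ d c → x ⊗ d ⊕ y ⊗ c ⊕ ⊝ (τ ⊗ d) ≡ (x ⊕ ⊝ τ) ⊗ d ⊕ y ⊗ c
    shift = solve 5 (λ x y τ d c → (x :* d :+ y :* c :+ :- (τ :* d)) ⊜ ((x :+ :- τ) :* d :+ y :* c)) refl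
    shift-identity : ∀ u j v l → ⟦ block (u , j) (v , l) ⟧ ⊖ fromℤ (𝟙 (u ≟ v) * 𝟙 (j ≟ l))
                                 ≡ (𝕏 u v ⊖ fromℤ (𝟙 (u ≟ v))) ⊗ δ′ j l ⊕ 𝕐 u v ⊗ C′ j l
    shift-identity u j v l = trans (cong₂ _⊖_ (⟦block⟧ u j v l) (fromℤ-* (𝟙 (u ≟ v)) (𝟙 (j ≟ l))))
                                   (shift (𝕏 u v) (𝕐 u v) (fromℤ (𝟙 (u ≟ v))) (δ′ j l) (C′ j l))

  doubled-isSkewType : IsSkewType (2 ℕ.* m) doubled
  doubled-isSkewType k l = begin
    conj (⟦ doubled l k ⟧ ⊖ δ l k)
      ≡⟨ cong (λ z → conj (⟦ doubled l k ⟧ ⊖ z)) (δ-doubled l k) ⟩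
    conj (⟦ doubled l k ⟧ ⊖ fromℤ (𝟙 (block-of l ≟ block-of k) * 𝟙 (index-of l ≟ index-of k)))
      ≡⟨ block-skew (block-of k) (index-of k) (block-of l) (index-of l) ⟩
    ⊝ (⟦ doubled k l ⟧ ⊖ fromℤ (𝟙 (block-of k ≟ block-of l) * 𝟙 (index-of k ≟ index-of l)))
      ≡⟨ cong (λ z → ⊝ (⟦ doubled k l ⟧ ⊖ z)) (δ-doubled k l) ⟨
    ⊝ (⟦ doubled k l ⟧ ⊖ δ k l) ∎
    where open ≡-Reasoning

  block-row-sum : ∀ u j → sumᵢ (λ w → sumᵢ (λ l → ⟦ block (u , j) (w , l) ⟧))
                          ≡ sumᵢ (λ w → 𝕏 u w ⊕ 𝕐 u w ⊗ fromℤ r)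
  block-row-sum u j = sumᵢ-cong-≗ λ w → begin
    sumᵢ (λ l → ⟦ block (u , j) (w , l) ⟧)
      ≡⟨ sumᵢ-cong-≗ (⟦block⟧ u j w) ⟩
    sumᵢ (λ l → 𝕏 u w ⊗ δ′ j l ⊕ 𝕐 u w ⊗ C′ j l)
      ≡⟨ sumᵢ-linear (𝕏 u w) (𝕐 u w) (λ l → 𝟙 (j ≟ l)) (C j) ⟩
    𝕏 u w ⊗ fromℤ (sum (λ l → 𝟙 (j ≟ l))) ⊕ 𝕐 u w ⊗ fromℤ (sum (C j))
      ≡⟨ cong₂ (λ a b → 𝕏 u w ⊗ fromℤ a ⊕ 𝕐 u w ⊗ fromℤ b) (sum-𝟙≟ j) (C-row-sum j) ⟩
    𝕏 u w ⊗ 1ᵢ ⊕ 𝕐 u w ⊗ fromℤ r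
      ≡⟨ unit (𝕏 u w) (𝕐 u w ⊗ fromℤ r) ⟩
    𝕏 u w ⊕ 𝕐 u w ⊗ fromℤ r ∎
    where
    open ≡-Reasoning
    unit : ∀ a b → a ⊗ 1ᵢ ⊕ b ≡ a ⊕ b
    unit = solve 2 (λ a b → (a :* con 1ᵢ :+ b) ⊜ (a :+ b)) refl

  doubled-row-sum : ∀ k → rowSum (2 ℕ.* m) doubled k ≡ sumᵢ (λ w → 𝕏 (block-of k) w ⊕ 𝕐 (block-of k) w ⊗ fromℤ r)
  doubled-row-sum k = begin
    ∑ (2 ℕ.* m) (λ l → ⟦ doubled k l ⟧)   ≡⟨ ∑≡sumᵢ (2 ℕ.* m) (λ l → ⟦ doubled k l ⟧) ⟩
    sumᵢ (λ l → G (remQuot {2} m l))      ≡⟨ FiniteSums.sum-remQuot (CommutativeRing.semiring ℤ[i]-commutativeRing) 2 m G ⟩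
    sumᵢ (λ w → sumᵢ (λ l → G (w , l)))   ≡⟨ block-row-sum (block-of k) (index-of k) ⟩
    sumᵢ (λ w → 𝕏 (block-of k) w ⊕ 𝕐 (block-of k) w ⊗ fromℤ r) ∎
    where
    open ≡-Reasoning
    G : Fin 2 × Fin m → ℤ[i]
    G V = ⟦ block (remQuot {2} m k) V ⟧

  block-row-sum-semiRegular : ∀ u → InSemiRegularSet (r + 1ℤ) (r - 1ℤ) (sumᵢ (λ w → 𝕏 u w ⊕ 𝕐 u w ⊗ fromℤ r))
  block-row-sum-semiRegular 0F = subst (InSemiRegularSet (r + 1ℤ) (r - 1ℤ))
    (sym (trans (ring (fromℤ r)) (fromℤ⊕𝕚⊗fromℤ (1ℤ - r) (1ℤ + r))))
    (inj₂ (inj₂ (flip r) , inj₁ (ℤₚ.+-comm 1ℤ r)))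
    where
    ring : ∀ ρ → (1ᵢ ⊕ 𝕚 ⊗ ρ) ⊕ ((𝕚 ⊕ ⊝ 1ᵢ ⊗ ρ) ⊕ 0ᵢ) ≡ (1ᵢ ⊕ ⊝ ρ) ⊕ 𝕚 ⊗ (1ᵢ ⊕ ρ)
    ring = solve 1 (λ ρ → ((con 1ᵢ :+ con 𝕚 :* ρ) :+ ((con 𝕚 :+ :- con 1ᵢ :* ρ) :+ con 0ᵢ))
                          ⊜ ((con 1ᵢ :+ :- ρ) :+ con 𝕚 :* (con 1ᵢ :+ ρ))) refl
    flip : ∀ r → 1ℤ - r ≡ - (r - 1ℤ)
    flip = solve-∀
  block-row-sum-semiRegular 1F = subst (InSemiRegularSet (r + 1ℤ) (r - 1ℤ))
    (sym (trans (ring (fromℤ r)) (fromℤ⊕𝕚⊗fromℤ (1ℤ + r) (1ℤ - r))))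
    (inj₁ (inj₁ (ℤₚ.+-comm 1ℤ r) , inj₂ (flip r)))
    where
    ring : ∀ ρ → (𝕚 ⊕ 1ᵢ ⊗ ρ) ⊕ ((1ᵢ ⊕ ⊝ 𝕚 ⊗ ρ) ⊕ 0ᵢ) ≡ (1ᵢ ⊕ ρ) ⊕ 𝕚 ⊗ (1ᵢ ⊕ ⊝ ρ)
    ring = solve 1 (λ ρ → ((con 𝕚 :+ con 1ᵢ :* ρ) :+ ((con 1ᵢ :+ :- con 𝕚 :* ρ) :+ con 0ᵢ))
                          ⊜ ((con 1ᵢ :+ ρ) :+ con 𝕚 :* (con 1ᵢ :+ :- ρ))) refl
    flip : ∀ r → 1ℤ - r ≡ - (r - 1ℤ)
    flip = solve-∀

  doubled-isSemiRegular : + n ≡ r * r → IsSemiRegular (2 ℕ.* m) doubled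
  doubled-isSemiRegular n≡r² = r + 1ℤ , r - 1ℤ , order , row-sums
    where
    squares : ∀ r → + 2 * (1ℤ + r * r) ≡ (r + 1ℤ) * (r + 1ℤ) + (r - 1ℤ) * (r - 1ℤ)
    squares = solve-∀
    order : + (2 ℕ.* m) ≡ (r + 1ℤ) * (r + 1ℤ) + (r - 1ℤ) * (r - 1ℤ)
    order = trans (ℤₚ.pos-* 2 m) (trans (cong (λ x → + 2 * (1ℤ + x)) n≡r²) (squares r))
    row-sums : ∀ k → InSemiRegularSet (r + 1ℤ) (r - 1ℤ) (rowSum (2 ℕ.* m) doubled k)
    row-sums k = subst (InSemiRegularSet (r + 1ℤ) (r - 1ℤ)) (sym (doubled-row-sum k)) (block-row-sum-semiRegular (block-of k))

parity : ∀ n → ∃[ h ] (n ≡ h ℕ.+ h ⊎ n ≡ suc (h ℕ.+ h))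
parity zero = 0 , inj₁ refl
parity (suc n) with parity n
... | h , inj₁ refl = h , inj₂ refl
... | h , inj₂ refl = suc h , inj₁ (cong suc (sym (ℕₚ.+-suc h h)))

2∣h+h : ∀ h → 2 ℕ∣.∣ h ℕ.+ h
2∣h+h h = ℕ∣.divides h (trans (cong (h ℕ.+_) (sym (ℕₚ.+-identityʳ h))) (ℕₚ.*-comm 2 h))

odd-prime-half : ∀ {p} → Prime p → p ≢ 2 → ∃[ h ] p ≡ suc (h ℕ.+ h)
odd-prime-half {p} p-prime p≢2 with parity p
... | h , inj₂ p≡1+2h = h , p≡1+2h
... | h , inj₁ refl with prime⇒irreducible p-prime (2∣h+h h)
...   | inj₁ ()
...   | inj₂ 2≡p = contradiction (sym 2≡p) p≢2

open import Data.Nat using (ℕ; _+_; _*_)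
open import Data.Nat.Primality using (Prime)
open import Data.Product using (_×_; ∃-syntax)
open import Relation.Binary.PropositionalEquality using (_≢_)

corollary4p10 : ∀ (p : ℕ) → Prime p → p ≢ 2 →
    ∃[ H ] (IsQuaternaryHadamard (2 + 2 * (p * p)) H
            × IsSkewType (2 + 2 * (p * p)) H
            × IsSemiRegular (2 + 2 * (p * p)) H)
corollary4p10 p p-prime p≢2 =
  subst (λ N → ∃[ H ] (IsQuaternaryHadamard N H × IsSkewType N H × IsSemiRegular N H))
        (ℕₚ.*-suc 2 (p * p))
        (doubled , doubled-isQuaternaryHadamard , doubled-isSkewType , doubled-isSemiRegular (ℤₚ.pos-* p p))
  where
  half : ∃[ h ] p ≡ suc (h + h)
  half = odd-prime-half p-prime p≢2
  open OddPlaneConference p p-prime (proj₁ half) (proj₂ half)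
  open Doubling bordered-isSymmetricConferenceMatrix bordered-row-sum
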